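{- Let $w\in\Sigma_n$ and let $R$ be an rc-graph associated to $w$. Define $R_0=R$ and, for $i\ge 0$ while $R_i\ne P_n$, let $R_{i+1}=R_i\cup\{(k,b)\}$ where $(k,b)$ is the lexicographically minimal pair in $P_n\setminus R_i$; this gives a sequence $R=R_0,R_1,\dots,R_{\ell(w_0)-\ell(w)}$. Then: (1) every $R_i$ is an rc-graph; (2) $w=w(R_0)\lessdot w(R_1)\lessdot\cdots\lessdot w(R_{\ell(w_0)-\ell(w)})=w_0$ is a saturated chain in the Bruhat order; (3) if $R_{i+1}$ is obtained from $R_i$ by adding $(k,b)$, then $w(R_i)\xrightarrow{(k,b)}w(R_{i+1})$ is a labeled cover in the labeled Bruhat order; (4) the labeled chain with the labels from (3) is increasing.
   Context: $\Sigma_n$ is the symmetric group on $\{1,\dots,n\}$, $\ell(w)$ the number of inversions, $w_0=n\cdots21$, $s_a=(a,a{+}1)$. Let $P_n=\{(k,b)\in\mathbb{Z}_{>0}^2: k+b\le n\}$. For $R\subseteq P_n$ order its elements by $(k,b)\le(j,a)$ iff $k<j$, or $k=j$ and $b\ge a$; if $(k_1,b_1),(k_2,b_2),\dots,(k_m,b_m)$ are the elements of $R$ in this order, set $d(R)=(k_1+b_1-1,\dots,k_m+b_m-1)$. $R$ is an rc-graph associated to $w$ (written $w=w(R)$) if $d(R)$ is a reduced decomposition of $w$, i.e. $w=s_{k_1+b_1-1}\cdots s_{k_m+b_m-1}$ with $m=\ell(w)$; an rc-graph is a subset $R\subseteq P_n$ associated to some permutation. The lexicographic order on pairs is $(k,b)<(j,a)$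 iff $k<j$, or $k=j$ and $b<a$. Bruhat covers: $u\lessdot v$ iff $v=u\cdot(k,l)$ (swapping positions $k<l$) with $u(k)<u(l)$ and no $k<i<l$ has $u(k)<u(i)<u(l)$. The labeled Bruhat order has an edge $u\xrightarrow{(k,b)}v$ whenever $u\lessdot v$, $u^{ -1}v=(i,j)$ with $i\le k<j$ and $b=u(i)=v(j)$. A chain of such edges is increasing if its labels strictly increase lexicographically. -}

module Defs where

open import Data.Nat using (ℕ; zero; suc; _+_; _∸_; _≤_; _<_; _≡ᵇ_; _<ᵇ_)
open import Data.Bool using (Bool; true; false; if_then_else_; _∨_; _∧_; not)
open import Data.List using (List; []; _∷_; map; filterᵇ; upTo; length; reverse; concatMap; foldl)
open import Data.List.Relation.Unary.All using (All)
open import Data.List.Relation.Binary.Permutation.Propositional using (_↭_)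
open import Data.Sum using (_⊎_)
open import Data.Maybe using (Maybe; just; nothing)
open import Data.Product using (_×_; _,_; ∃; ∃-syntax; proj₁; proj₂)
open import Relation.Binary.PropositionalEquality using (_≡_)
open import Relation.Nullary using (¬_)
open import Relation.Nullary.Decidable using (does)
import Data.Nat as ℕ

-- Permutations in one-line notation: w ∈ Σₙ is the list w(1) … w(n).

range : ℕ → List ℕ
range n = map suc (upTo n)

IsPerm : ℕ → List ℕ → Set
IsPerm n w = w ↭ range n

-- value at 1-indexed position (0 if out of range)
at : List ℕ → ℕ → ℕ
at []       _             = 0
at (x ∷ xs) zero          = 0
at (x ∷ xs) (suc zero)    = x
at (x ∷ xs) (suc (suc p)) = at xs (suc p)

swapAt : List ℕ → ℕ → ℕ → List ℕ
swapAt u i j = map f (range (length u))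
  where
  f : ℕ → ℕ
  f p = if p ≡ᵇ i then at u j else (if p ≡ᵇ j then at u i else at u p)

countLess : ℕ → List ℕ → ℕ
countLess x []       = 0
countLess x (y ∷ ys) = (if y <ᵇ x then 1 else 0) + countLess x ys

inv : List ℕ → ℕ
inv []       = 0
inv (x ∷ xs) = countLess x xs + inv xs

w₀ : ℕ → List ℕ
w₀ n = reverse (range n)

-- the product s_{a₁} s_{a₂} ⋯ s_{aₘ} ∈ Σₙ (right multiplication by s_a
-- swaps positions a and a+1 in one-line notation)
prod : ℕ → List ℕ → List ℕ
prod n word = foldl (λ u a → swapAt u a (suc a)) (range n) word

IsReducedDecomp : ℕ → List ℕ → List ℕ → Set
IsReducedDecomp n word w =
  All (λ a → 1 ≤ a × a < n) word × prod n word ≡ w × length word ≡ inv w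

CoverAt : ℕ → List ℕ → ℕ → ℕ → List ℕ → Set
CoverAt n u k l v =
  1 ≤ k × k < l × l ≤ n × v ≡ swapAt u k l × at u k < at u l ×
  (∀ i → k < i → i < l → ¬ (at u k < at u i × at u i < at u l))

Cover : ℕ → List ℕ → List ℕ → Set
Cover n u v = ∃[ k ] ∃[ l ] CoverAt n u k l v

LabeledCover : ℕ → List ℕ → ℕ × ℕ → List ℕ → Set
LabeledCover n u (k , b) v =
  ∃[ i ] ∃[ j ] (CoverAt n u i j v × i ≤ k × k < j × b ≡ at u i × b ≡ at v j)

_<lex_ : ℕ × ℕ → ℕ × ℕ → Set
(k , b) <lex (j , a) = k < j ⊎ (k ≡ j × b < a)

-- Subsets of Pₙ = {(k,b) ∈ ℤ>0² : k + b ≤ n}, as Boolean predicates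

Subset : Set
Subset = ℕ × ℕ → Bool

InPn : ℕ → ℕ × ℕ → Set
InPn n (k , b) = 1 ≤ k × 1 ≤ b × k + b ≤ n

SubsetOfPn : ℕ → Subset → Set
SubsetOfPn n R = ∀ p → R p ≡ true → InPn n p

-- Pₙ listed in the rc-order: k increasing, and for equal k, b decreasing
PnRC : ℕ → List (ℕ × ℕ)
PnRC n = concatMap (λ k → map (λ b → (k , b)) (reverse (range (n ∸ k)))) (range n)

PnLex : ℕ → List (ℕ × ℕ)
PnLex n = concatMap (λ k → map (λ b → (k , b)) (range (n ∸ k))) (range n)

d : ℕ → Subset → List ℕ
d n R = map (λ { (k , b) → k + b ∸ 1 }) (filterᵇ R (PnRC n))

IsRCGraphOf : ℕ → Subset → List ℕ → Set
IsRCGraphOf n R w = IsPerm n w × IsReducedDecomp n (d n R) w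

IsRCGraph : ℕ → Subset → Set
IsRCGraph n R = ∃[ v ] IsRCGraphOf n R v

wOf : ℕ → Subset → List ℕ
wOf n R = prod n (d n R)

firstMissing : Subset → List (ℕ × ℕ) → Maybe (ℕ × ℕ)
firstMissing R []       = nothing
firstMissing R (p ∷ ps) = if R p then firstMissing R ps else just p

nextPair : ℕ → Subset → Maybe (ℕ × ℕ)
nextPair n R = firstMissing R (PnLex n)

insert : ℕ × ℕ → Subset → Subset
insert (k , b) R (j , a) = ((j ≡ᵇ k) ∧ (a ≡ᵇ b)) ∨ R (j , a)

chain : ℕ → Subset → ℕ → Subset
chain n R zero    = R
chain n R (suc i) with nextPair n (chain n R i)
... | nothing = chain n R i
... | just p  = insert p (chain n R i)

-- Write d(R) row by row. If R contains every pair of Pₙ lexicographically below the next pair (k,b), then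
-- rows 1, …, k−1 are full and row k contains (k,1), …, (k,b−1), so d(R) = P H (s_{k+b−2} ⋯ s_k) S, and
-- inserting (k,b) only lengthens the middle factor to s_{k+b−1} ⋯ s_k; the letters of H are ≥ k+b and
-- those of S are > k. Since the rows before k are full, x = w(P H) reads 1, …, b at the positions
-- k, …, k+b−1 while y = x(k+b) > b. Hence w(R ∪ {(k,b)}) arises from w(R) by exchanging the values
-- b and y, which sit at positions k < j. A word is reduced iff each letter is an ascent, and the ascents
-- of S (all at positions > k) survive the exchange as long as no value strictly between b and y lies
-- between positions k and j; so the new word is again reduced and w(R) → w(R ∪ {(k,b)}) is a Bruhat
-- cover labelled (k,b). Pairs are inserted in lexicographic order, so the labels increase, and the
-- process ends at Pₙ, whose word is a reduced word of w₀, after ℓ(w₀) − ℓ(w) steps.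

module Submission where

open import Defs
open import Data.Bool using (Bool; true; false; if_then_else_; _∧_; T)
open import Data.Bool.Properties using (T-≡; T?; ∧-zeroʳ; ∨-zeroʳ)
open import Data.Empty using (⊥-elim)
open import Data.List using (List; []; _∷_; _++_; map; concat; concatMap; length; foldl; applyUpTo; reverse; filterᵇ)
open import Data.List.Properties
  using ( length-map; length-filter; map-upTo; map-++; map-cong; map-cong-local; map-concatMap; concatMap-cong
        ; concatMap-++; ++-assoc; ++-identityʳ; reverse-++; foldl-++
        ; filter-accept; filter-reject; filter-all; filter-++; filter-complete )
open import Data.List.Membership.Propositional using (_∈_)
open import Data.List.Membership.Propositional.Properties using (∈-map⁺; ∈-upTo⁺; ∈-concat⁺′; ∈-++⁻; ∈-++⁺ʳ)
open import Data.List.Relation.Binary.Permutation.Propositional using (_↭_; ↭-refl; ↭-trans)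
import Data.List.Relation.Binary.Permutation.Propositional as ↭
open import Data.List.Relation.Unary.All using (All; []; _∷_)
import Data.List.Relation.Unary.All as All
open import Data.List.Relation.Unary.All.Properties using (++⁺; concat⁺; map⁺; filter⁺; all-filter; applyUpTo⁺₁)
open import Data.List.Relation.Unary.AllPairs using (AllPairs)
import Data.List.Relation.Unary.AllPairs as AllPairs
import Data.List.Relation.Unary.AllPairs.Properties as AllPairs
open import Data.List.Relation.Unary.Any using (here; there)
open import Data.Maybe using (just; nothing)
open import Data.Nat using (ℕ; zero; suc; _+_; _∸_; _≤_; _<_; _≡ᵇ_; _<ᵇ_; z≤n; s≤s; _≟_)
open import Data.Nat.Properties
open import Data.Nat.Tactic.RingSolver using (solve-∀)
open import Data.Product using (_×_; _,_; ∃-syntax; proj₁; proj₂)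
open import Data.Sum using (_⊎_; inj₁; inj₂)
open import Data.Unit using (⊤; tt)
open import Function using (_∘_; id; Equivalence)
open import Relation.Binary using (tri<; tri≈; tri>)
open import Relation.Binary.PropositionalEquality
open import Relation.Nullary using (¬_; yes; no)

≡ᵇ-refl : ∀ m → (m ≡ᵇ m) ≡ true
≡ᵇ-refl zero    = refl
≡ᵇ-refl (suc m) = ≡ᵇ-refl m

≢⇒≡ᵇ-false : ∀ {m n} → m ≢ n → (m ≡ᵇ n) ≡ false
≢⇒≡ᵇ-false {zero}  {zero}  m≢n = ⊥-elim (m≢n refl)
≢⇒≡ᵇ-false {zero}  {suc n} m≢n = refl
≢⇒≡ᵇ-false {suc m} {zero}  m≢n = refl
≢⇒≡ᵇ-false {suc m} {suc n} m≢n = ≢⇒≡ᵇ-false (m≢n ∘ cong suc)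

<⇒<ᵇ-true : ∀ {m n} → m < n → (m <ᵇ n) ≡ true
<⇒<ᵇ-true m<n = Equivalence.to T-≡ (<⇒<ᵇ m<n)

≮⇒<ᵇ-false : ∀ {m n} → ¬ (m < n) → (m <ᵇ n) ≡ false
≮⇒<ᵇ-false {m} {n} m≮n with m <ᵇ n in eq
... | false = refl
... | true  = ⊥-elim (m≮n (<ᵇ⇒< m n (Equivalence.from T-≡ eq)))

true≢false : true ≢ false
true≢false ()

indicator : Bool → ℕ
indicator c = if c then 1 else 0

indicator≤1 : ∀ c → indicator c ≤ 1
indicator≤1 true  = ≤-refl
indicator≤1 false = z≤n

transpose : ℕ → ℕ → ℕ → ℕ
transpose i j p = if p ≡ᵇ i then j else (if p ≡ᵇ j then i else p)

transpose-left : ∀ i j → transpose i j i ≡ j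
transpose-left i j rewrite ≡ᵇ-refl i = refl

transpose-right : ∀ {i j} → j ≢ i → transpose i j j ≡ i
transpose-right {i} {j} j≢i rewrite ≢⇒≡ᵇ-false j≢i | ≡ᵇ-refl j = refl

transpose-fixed : ∀ {i j p} → p ≢ i → p ≢ j → transpose i j p ≡ p
transpose-fixed p≢i p≢j rewrite ≢⇒≡ᵇ-false p≢i | ≢⇒≡ᵇ-false p≢j = refl

data TransposeCase (i j p : ℕ) : Set where
  moved-left  : p ≡ i → transpose i j p ≡ j → TransposeCase i j p
  moved-right : p ≢ i → p ≡ j → transpose i j p ≡ i → TransposeCase i j p
  fixed       : p ≢ i → p ≢ j → transpose i j p ≡ p → TransposeCase i j p

transpose-case : ∀ i j p → TransposeCase i j p
transpose-case i j p with p ≟ i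
... | yes refl = moved-left refl (transpose-left i j)
... | no p≢i with p ≟ j
...   | yes refl = moved-right p≢i refl (transpose-right p≢i)
...   | no p≢j   = fixed p≢i p≢j (transpose-fixed p≢i p≢j)

transpose-involutive : ∀ i j p → transpose i j (transpose i j p) ≡ p
transpose-involutive i j p with transpose-case i j p
... | moved-left refl e rewrite e with j ≟ p
...   | yes refl = transpose-left p p
...   | no j≢p   = transpose-right j≢p
transpose-involutive i j p | moved-right _ refl e rewrite e = transpose-left i p
transpose-involutive i j p | fixed p≢i p≢j e rewrite e = transpose-fixed p≢i p≢j

transpose-injective : ∀ i j {p q} → transpose i j p ≡ transpose i j q → p ≡ q
transpose-injective i j {p} {q} e = begin
  p                                    ≡⟨ transpose-involutive i j p ⟨
  transpose i j (transpose i j p)      ≡⟨ cong (transpose i j) e ⟩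
  transpose i j (transpose i j q)      ≡⟨ transpose-involutive i j q ⟩
  q                                    ∎
  where open ≡-Reasoning

transpose-suc : ∀ i j p → transpose (suc i) (suc j) (suc p) ≡ suc (transpose i j p)
transpose-suc i j p with p ≡ᵇ i
... | true  = refl
... | false with p ≡ᵇ j
...   | true  = refl
...   | false = refl

s[_] : ℕ → ℕ → ℕ
s[ a ] = transpose a (suc a)

s-below : ∀ {a p} → p < a → s[ a ] p ≡ p
s-below {a} p<a = transpose-fixed (<⇒≢ p<a) (<⇒≢ (m<n⇒m<1+n p<a))

s-above : ∀ {a p} → suc a < p → s[ a ] p ≡ p
s-above 1+a<p = transpose-fixed (≢-sym (<⇒≢ (<-trans (n<1+n _) 1+a<p))) (≢-sym (<⇒≢ 1+a<p))

s-lower : ∀ a → s[ a ] a ≡ suc a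
s-lower a = transpose-left a (suc a)

s-upper : ∀ a → s[ a ] (suc a) ≡ a
s-upper a = transpose-right 1+n≢n

s-preserves-interval : ∀ a lo hi p → lo ≤ a → suc a ≤ hi → lo ≤ p → p ≤ hi →
  lo ≤ s[ a ] p × s[ a ] p ≤ hi
s-preserves-interval a lo hi p lo≤a a<hi lo≤p p≤hi with transpose-case a (suc a) p
... | moved-left refl e      rewrite e = m≤n⇒m≤1+n lo≤a , a<hi
... | moved-right _ refl e   rewrite e = lo≤a , <⇒≤ a<hi
... | fixed _ _ e            rewrite e = lo≤p , p≤hi

consecutive : ℕ → ℕ → List ℕ
consecutive a zero    = []
consecutive a (suc m) = a ∷ consecutive (suc a) m

consecutive-snoc : ∀ a m → consecutive a (suc m) ≡ consecutive a m ++ (a + m) ∷ []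
consecutive-snoc a zero    = cong (_∷ []) (sym (+-identityʳ a))
consecutive-snoc a (suc m) =
  cong (a ∷_) (trans (consecutive-snoc (suc a) m) (cong (λ t → consecutive (suc a) m ++ t ∷ []) (sym (+-suc a m))))

consecutive-++ : ∀ a m m′ → consecutive a (m + m′) ≡ consecutive a m ++ consecutive (a + m) m′
consecutive-++ a zero    m′ = cong (λ t → consecutive t m′) (sym (+-identityʳ a))
consecutive-++ a (suc m) m′ =
  cong (a ∷_) (trans (consecutive-++ (suc a) m m′) (cong (λ t → consecutive (suc a) m ++ consecutive t m′) (sym (+-suc a m))))

applyUpTo≡consecutive : ∀ (g : ℕ → ℕ) a m → (∀ i → g i ≡ a + i) → applyUpTo g m ≡ consecutive a m
applyUpTo≡consecutive g a zero    g≗a+ = refl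
applyUpTo≡consecutive g a (suc m) g≗a+ =
  cong₂ _∷_ (trans (g≗a+ 0) (+-identityʳ a))
    (applyUpTo≡consecutive (g ∘ suc) (suc a) m (λ i → trans (g≗a+ (suc i)) (+-suc a i)))

range≡consecutive : ∀ n → range n ≡ consecutive 1 n
range≡consecutive n = trans (map-upTo suc n) (applyUpTo≡consecutive suc 1 n (λ _ → refl))

all-consecutive : ∀ {P : ℕ → Set} a m → (∀ j → a ≤ j → j < a + m → P j) → All P (consecutive a m)
all-consecutive a zero    _ = []
all-consecutive a (suc m) h = h a ≤-refl (≤-trans (s≤s (m≤m+n a m)) (≤-reflexive (sym (+-suc a m))))
  ∷ all-consecutive (suc a) m (λ j a<j j<a+m → h j (<⇒≤ a<j) (<-≤-trans j<a+m (≤-reflexive (sym (+-suc a m)))))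

length-consecutive : ∀ a m → length (consecutive a m) ≡ m
length-consecutive a zero    = refl
length-consecutive a (suc m) = cong suc (length-consecutive (suc a) m)

length-range : ∀ n → length (range n) ≡ n
length-range n = trans (cong length (range≡consecutive n)) (length-consecutive 1 n)

at-consecutive : ∀ a m i → i < m → at (consecutive a m) (suc i) ≡ a + i
at-consecutive a (suc m) zero    _         = sym (+-identityʳ a)
at-consecutive a (suc m) (suc i) (s≤s i<m) = trans (at-consecutive (suc a) m i i<m) (sym (+-suc a i))

at-range : ∀ n p → 1 ≤ p → p ≤ n → at (range n) p ≡ p
at-range n (suc i) _ p≤n = trans (cong (λ l → at l (suc i)) (range≡consecutive n)) (at-consecutive 1 n i p≤n)

at-map : ∀ (f : ℕ → ℕ) l p → 1 ≤ p → p ≤ length l → at (map f l) p ≡ f (at l p)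
at-map f (x ∷ l) (suc zero)    _ _         = refl
at-map f (x ∷ l) (suc (suc q)) _ (s≤s p≤l) = at-map f l (suc q) (s≤s z≤n) p≤l

at-if : ∀ u (c : Bool) x y → at u (if c then x else y) ≡ (if c then at u x else at u y)
at-if u true  x y = refl
at-if u false x y = refl

at-ext : ∀ (u v : List ℕ) → length u ≡ length v →
  (∀ p → 1 ≤ p → p ≤ length u → at u p ≡ at v p) → u ≡ v
at-ext []      []      _ _ = refl
at-ext (x ∷ u) (y ∷ v) e u≗v =
  cong₂ _∷_ (u≗v 1 (s≤s z≤n) (s≤s z≤n))
    (at-ext u v (suc-injective e) (λ { (suc q) _ q≤u → u≗v (suc (suc q)) (s≤s z≤n) (s≤s q≤u) }))

length-swapAt : ∀ u i j → length (swapAt u i j) ≡ length u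
length-swapAt u i j = trans (length-map _ (range (length u))) (length-range (length u))

at-swapAt : ∀ u i j p → 1 ≤ p → p ≤ length u → at (swapAt u i j) p ≡ at u (transpose i j p)
at-swapAt u i j p 1≤p p≤u = begin
  at (swapAt u i j) p
    ≡⟨ at-map _ (range (length u)) p 1≤p (subst (p ≤_) (sym (length-range (length u))) p≤u) ⟩
  (if at (range (length u)) p ≡ᵇ i then at u j else (if at (range (length u)) p ≡ᵇ j then at u i else at u (at (range (length u)) p)))
    ≡⟨ cong (λ q → if q ≡ᵇ i then at u j else (if q ≡ᵇ j then at u i else at u q)) (at-range (length u) p 1≤p p≤u) ⟩
  (if p ≡ᵇ i then at u j else (if p ≡ᵇ j then at u i else at u p))
    ≡⟨ sym (trans (at-if u (p ≡ᵇ i) j _) (cong (if p ≡ᵇ i then at u j else_) (at-if u (p ≡ᵇ j) i p))) ⟩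
  at u (transpose i j p)
    ∎
  where open ≡-Reasoning

swapFirstTwo : List ℕ → List ℕ
swapFirstTwo (x ∷ y ∷ r) = y ∷ x ∷ r
swapFirstTwo u           = u

swapAdjacent : List ℕ → ℕ → List ℕ
swapAdjacent u       zero          = u
swapAdjacent u       (suc zero)    = swapFirstTwo u
swapAdjacent []      (suc (suc a)) = []
swapAdjacent (x ∷ r) (suc (suc a)) = x ∷ swapAdjacent r (suc a)

at-swapAdjacent : ∀ u a p → 1 ≤ a → suc a ≤ length u → at (swapAdjacent u a) p ≡ at u (s[ a ] p)
at-swapAdjacent (x ∷ y ∷ r) (suc zero) zero                _ _ = refl
at-swapAdjacent (x ∷ y ∷ r) (suc zero) (suc zero)          _ _ = refl
at-swapAdjacent (x ∷ y ∷ r) (suc zero) (suc (suc zero))    _ _ = refl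
at-swapAdjacent (x ∷ y ∷ r) (suc zero) (suc (suc (suc p))) _ _ = refl
at-swapAdjacent (x ∷ [])    (suc zero) p _ (s≤s ())
at-swapAdjacent (x ∷ r) (suc (suc a)) zero       _ _ = refl
at-swapAdjacent (x ∷ r) (suc (suc a)) (suc zero) _ _ = refl
at-swapAdjacent (x ∷ r) (suc (suc a)) (suc (suc q)) _ (s≤s a<r)
  rewrite transpose-suc (suc a) (suc (suc a)) (suc q) | transpose-suc a (suc a) q =
  trans (at-swapAdjacent r (suc a) (suc q) (s≤s z≤n) a<r) (cong (at r) (transpose-suc a (suc a) q))

length-swapAdjacent : ∀ u a → length (swapAdjacent u a) ≡ length u
length-swapAdjacent u           zero          = refl
length-swapAdjacent []          (suc zero)    = refl
length-swapAdjacent (x ∷ [])    (suc zero)    = refl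
length-swapAdjacent (x ∷ y ∷ r) (suc zero)    = refl
length-swapAdjacent []          (suc (suc a)) = refl
length-swapAdjacent (x ∷ r)     (suc (suc a)) = cong suc (length-swapAdjacent r (suc a))

swapAdjacent-↭ : ∀ u a → swapAdjacent u a ↭ u
swapAdjacent-↭ u           zero          = ↭-refl
swapAdjacent-↭ []          (suc zero)    = ↭-refl
swapAdjacent-↭ (x ∷ [])    (suc zero)    = ↭-refl
swapAdjacent-↭ (x ∷ y ∷ r) (suc zero)    = ↭.swap y x ↭-refl
swapAdjacent-↭ []          (suc (suc a)) = ↭-refl
swapAdjacent-↭ (x ∷ r)     (suc (suc a)) = ↭.prep x (swapAdjacent-↭ r (suc a))

swapAt≡swapAdjacent : ∀ u a → 1 ≤ a → suc a ≤ length u → swapAt u a (suc a) ≡ swapAdjacent u a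
swapAt≡swapAdjacent u a 1≤a a<u =
  at-ext _ _ (trans (length-swapAt u a (suc a)) (sym (length-swapAdjacent u a)))
    (λ p 1≤p p≤ → trans (at-swapAt u a (suc a) p 1≤p (subst (p ≤_) (length-swapAt u a (suc a)) p≤))
                        (sym (at-swapAdjacent u a p 1≤a a<u)))

countLess-swapAdjacent : ∀ x u a → countLess x (swapAdjacent u a) ≡ countLess x u
countLess-swapAdjacent x u           zero          = refl
countLess-swapAdjacent x []          (suc zero)    = refl
countLess-swapAdjacent x (y ∷ [])    (suc zero)    = refl
countLess-swapAdjacent x (y ∷ z ∷ r) (suc zero)    =
  +-exchange (indicator (z <ᵇ x)) (indicator (y <ᵇ x)) (countLess x r)
  where
  +-exchange : ∀ p q r → p + (q + r) ≡ q + (p + r)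
  +-exchange = solve-∀
countLess-swapAdjacent x []          (suc (suc a)) = refl
countLess-swapAdjacent x (y ∷ r)     (suc (suc a)) =
  cong (indicator (y <ᵇ x) +_) (countLess-swapAdjacent x r (suc a))

inv-swapAdjacent : ∀ u a → 1 ≤ a → suc a ≤ length u →
  inv (swapAdjacent u a) + indicator (at u (suc a) <ᵇ at u a) ≡ inv u + indicator (at u a <ᵇ at u (suc a))
inv-swapAdjacent (x ∷ y ∷ r) (suc zero) _ _ =
  rearrange (indicator (x <ᵇ y)) (indicator (y <ᵇ x)) (countLess y r) (countLess x r) (inv r)
  where
  rearrange : ∀ a b c d e → (a + c) + (d + e) + b ≡ (b + d) + (c + e) + a
  rearrange = solve-∀
inv-swapAdjacent (x ∷ r) (suc (suc a)) _ (s≤s a<r) = begin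
  countLess x (swapAdjacent r (suc a)) + inv (swapAdjacent r (suc a)) + c
    ≡⟨ cong (λ t → t + inv (swapAdjacent r (suc a)) + c) (countLess-swapAdjacent x r (suc a)) ⟩
  countLess x r + inv (swapAdjacent r (suc a)) + c
    ≡⟨ +-assoc (countLess x r) _ _ ⟩
  countLess x r + (inv (swapAdjacent r (suc a)) + c)
    ≡⟨ cong (countLess x r +_) (inv-swapAdjacent r (suc a) (s≤s z≤n) a<r) ⟩
  countLess x r + (inv r + _)
    ≡⟨ +-assoc (countLess x r) _ _ ⟨
  countLess x r + inv r + _
    ∎
  where
  open ≡-Reasoning
  c : ℕ
  c = indicator (at r (suc (suc a)) <ᵇ at r (suc a))

inv-swapAdjacent-ascent : ∀ u a → 1 ≤ a → suc a ≤ length u → at u a < at u (suc a) →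
  inv (swapAdjacent u a) ≡ suc (inv u)
inv-swapAdjacent-ascent u a 1≤a a<u asc = begin
  inv (swapAdjacent u a)                                            ≡⟨ +-identityʳ _ ⟨
  inv (swapAdjacent u a) + 0                                        ≡⟨ cong (λ c → inv (swapAdjacent u a) + indicator c) (≮⇒<ᵇ-false (<⇒≯ asc)) ⟨
  inv (swapAdjacent u a) + indicator (at u (suc a) <ᵇ at u a)       ≡⟨ inv-swapAdjacent u a 1≤a a<u ⟩
  inv u + indicator (at u a <ᵇ at u (suc a))                        ≡⟨ cong (λ c → inv u + indicator c) (<⇒<ᵇ-true asc) ⟩
  inv u + 1                                                         ≡⟨ +-comm (inv u) 1 ⟩
  suc (inv u)                                                       ∎
  where open ≡-Reasoning

inv-swapAdjacent-descent : ∀ u a → 1 ≤ a → suc a ≤ length u → at u (suc a) < at u a →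
  suc (inv (swapAdjacent u a)) ≡ inv u
inv-swapAdjacent-descent u a 1≤a a<u desc = begin
  suc (inv (swapAdjacent u a))                                      ≡⟨ +-comm 1 _ ⟩
  inv (swapAdjacent u a) + 1                                        ≡⟨ cong (λ c → inv (swapAdjacent u a) + indicator c) (<⇒<ᵇ-true desc) ⟨
  inv (swapAdjacent u a) + indicator (at u (suc a) <ᵇ at u a)       ≡⟨ inv-swapAdjacent u a 1≤a a<u ⟩
  inv u + indicator (at u a <ᵇ at u (suc a))                        ≡⟨ cong (λ c → inv u + indicator c) (≮⇒<ᵇ-false (<⇒≯ desc)) ⟩
  inv u + 0                                                         ≡⟨ +-identityʳ _ ⟩
  inv u                                                             ∎
  where open ≡-Reasoning

inv-swapAdjacent-≤ : ∀ u a → 1 ≤ a → suc a ≤ length u → inv (swapAdjacent u a) ≤ suc (inv u)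
inv-swapAdjacent-≤ u a 1≤a a<u = begin
  inv (swapAdjacent u a)                                        ≤⟨ m≤m+n _ _ ⟩
  inv (swapAdjacent u a) + indicator (at u (suc a) <ᵇ at u a)   ≡⟨ inv-swapAdjacent u a 1≤a a<u ⟩
  inv u + indicator (at u a <ᵇ at u (suc a))                    ≤⟨ +-monoʳ-≤ (inv u) (indicator≤1 _) ⟩
  inv u + 1                                                     ≡⟨ +-comm (inv u) 1 ⟩
  suc (inv u)                                                   ∎
  where open ≤-Reasoning

inv-range : ∀ n → inv (range n) ≡ 0
inv-range n = trans (cong inv (range≡consecutive n)) (inv-consecutive 1 n)
  where
  countLess-consecutive : ∀ x a m → x ≤ a → countLess x (consecutive a m) ≡ 0
  countLess-consecutive x a zero    _   = refl
  countLess-consecutive x a (suc m) x≤a rewrite ≮⇒<ᵇ-false {a} {x} (≤⇒≯ x≤a) =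
    countLess-consecutive x (suc a) m (m≤n⇒m≤1+n x≤a)
  inv-consecutive : ∀ a m → inv (consecutive a m) ≡ 0
  inv-consecutive a zero    = refl
  inv-consecutive a (suc m) rewrite countLess-consecutive a (suc a) m (n≤1+n a) = inv-consecutive (suc a) m

length-++-++-∷ : ∀ {A : Set} (X Y : List A) a Z → length (X ++ Y ++ a ∷ Z) ≡ suc (length (X ++ Y ++ Z))
length-++-++-∷ []      []      a Z = refl
length-++-++-∷ []      (y ∷ Y) a Z = cong suc (length-++-++-∷ [] Y a Z)
length-++-++-∷ (x ∷ X) Y       a Z = cong suc (length-++-++-∷ X Y a Z)

ValidWord : ℕ → List ℕ → Set
ValidWord n W = All (λ a → 1 ≤ a × a < n) W

applyWord : List ℕ → List ℕ → List ℕ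
applyWord = foldl swapAdjacent

-- The position permutation of a word: applyWord u W = u ∘ ⟦ W ⟧.
⟦_⟧ : List ℕ → ℕ → ℕ
⟦ []    ⟧ p = p
⟦ a ∷ W ⟧ p = s[ a ] (⟦ W ⟧ p)

validWord-cast : ∀ {m n W} → m ≡ n → ValidWord n W → ValidWord m W
validWord-cast {W = W} m≡n = subst (λ k → ValidWord k W) (sym m≡n)

length-applyWord : ∀ u W → length (applyWord u W) ≡ length u
length-applyWord u []      = refl
length-applyWord u (a ∷ W) = trans (length-applyWord (swapAdjacent u a) W) (length-swapAdjacent u a)

prod≡applyWord : ∀ n W → ValidWord n W → prod n W ≡ applyWord (range n) W
prod≡applyWord n W valid = go (range n) W (validWord-cast (length-range n) valid)
  where
  go : ∀ u W → ValidWord (length u) W → foldl (λ v a → swapAt v a (suc a)) u W ≡ applyWord u W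
  go u []      _                   = refl
  go u (a ∷ W) ((1≤a , a<u) ∷ valid) rewrite swapAt≡swapAdjacent u a 1≤a a<u =
    go (swapAdjacent u a) W (validWord-cast (length-swapAdjacent u a) valid)

at-applyWord : ∀ u W p → ValidWord (length u) W → at (applyWord u W) p ≡ at u (⟦ W ⟧ p)
at-applyWord u []      p _                     = refl
at-applyWord u (a ∷ W) p ((1≤a , a<u) ∷ valid) =
  trans (at-applyWord (swapAdjacent u a) W p (validWord-cast (length-swapAdjacent u a) valid))
        (at-swapAdjacent u a (⟦ W ⟧ p) 1≤a a<u)

applyWord-↭ : ∀ u W → applyWord u W ↭ u
applyWord-↭ u []      = ↭-refl
applyWord-↭ u (a ∷ W) = ↭-trans (applyWord-↭ (swapAdjacent u a) W) (swapAdjacent-↭ u a)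

⟦⟧-++ : ∀ W V p → ⟦ W ++ V ⟧ p ≡ ⟦ W ⟧ (⟦ V ⟧ p)
⟦⟧-++ []      V p = refl
⟦⟧-++ (a ∷ W) V p = cong s[ a ] (⟦⟧-++ W V p)

⟦⟧-preserves-interval : ∀ lo hi W p → All (λ a → lo ≤ a × a < hi) W → lo ≤ p → p ≤ hi →
  lo ≤ ⟦ W ⟧ p × ⟦ W ⟧ p ≤ hi
⟦⟧-preserves-interval lo hi []      p _                      lo≤p p≤hi = lo≤p , p≤hi
⟦⟧-preserves-interval lo hi (a ∷ W) p ((lo≤a , a<hi) ∷ inW) lo≤p p≤hi =
  let (lo≤q , q≤hi) = ⟦⟧-preserves-interval lo hi W p inW lo≤p p≤hi
  in s-preserves-interval a lo hi (⟦ W ⟧ p) lo≤a a<hi lo≤q q≤hi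

⟦⟧-fixes-below : ∀ c hi W p → All (λ a → c ≤ a × a < hi) W → p < c → ⟦ W ⟧ p ≡ p
⟦⟧-fixes-below c hi []      p _                 p<c = refl
⟦⟧-fixes-below c hi (a ∷ W) p ((c≤a , _) ∷ inW) p<c
  rewrite ⟦⟧-fixes-below c hi W p inW p<c = s-below (<-≤-trans p<c c≤a)

at-applyWord-range : ∀ n W p → ValidWord n W → 1 ≤ p → p ≤ n → at (applyWord (range n) W) p ≡ ⟦ W ⟧ p
at-applyWord-range n W p valid 1≤p p≤n =
  let (1≤q , q≤n) = ⟦⟧-preserves-interval 1 n W p valid 1≤p p≤n
  in trans (at-applyWord (range n) W p (validWord-cast (length-range n) valid)) (at-range n (⟦ W ⟧ p) 1≤q q≤n)

InjectiveOn : ℕ → List ℕ → Set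
InjectiveOn n u = ∀ p q → 1 ≤ p → p ≤ n → 1 ≤ q → q ≤ n → at u p ≡ at u q → p ≡ q

range-injectiveOn : ∀ n → InjectiveOn n (range n)
range-injectiveOn n p q 1≤p p≤n 1≤q q≤n e = trans (sym (at-range n p 1≤p p≤n)) (trans e (at-range n q 1≤q q≤n))

swapAdjacent-injectiveOn : ∀ n u a → 1 ≤ a → suc a ≤ n → length u ≡ n → InjectiveOn n u →
  InjectiveOn n (swapAdjacent u a)
swapAdjacent-injectiveOn n u a 1≤a a<n u≡n inj p q 1≤p p≤n 1≤q q≤n e =
  let a<u = subst (suc a ≤_) (sym u≡n) a<n
      (1≤p′ , p′≤n) = s-preserves-interval a 1 n p 1≤a a<n 1≤p p≤n
      (1≤q′ , q′≤n) = s-preserves-interval a 1 n q 1≤a a<n 1≤q q≤n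
  in transpose-injective a (suc a) (inj _ _ 1≤p′ p′≤n 1≤q′ q′≤n
       (trans (sym (at-swapAdjacent u a p 1≤a a<u)) (trans e (at-swapAdjacent u a q 1≤a a<u))))

applyWord-injectiveOn : ∀ n u W → length u ≡ n → ValidWord n W → InjectiveOn n u → InjectiveOn n (applyWord u W)
applyWord-injectiveOn n u []      u≡n _                     inj = inj
applyWord-injectiveOn n u (a ∷ W) u≡n ((1≤a , a<n) ∷ valid) inj =
  applyWord-injectiveOn n (swapAdjacent u a) W (trans (length-swapAdjacent u a) u≡n) valid
    (swapAdjacent-injectiveOn n u a 1≤a a<n u≡n inj)

at-transpose : ∀ n u {i j b y} → InjectiveOn n u → 1 ≤ i → i ≤ n → 1 ≤ j → j ≤ n → at u i ≡ b → at u j ≡ y →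
  ∀ p → 1 ≤ p → p ≤ n → at u (transpose i j p) ≡ transpose b y (at u p)
at-transpose n u {i} {j} {b} {y} inj 1≤i i≤n 1≤j j≤n u-i u-j p 1≤p p≤n with transpose-case i j p
... | moved-left refl e rewrite e | u-i = trans u-j (sym (transpose-left b y))
... | moved-right p≢i refl e rewrite e | u-j =
      trans u-i (sym (transpose-right (λ y≡b → p≢i (inj p i 1≤p p≤n 1≤i i≤n (trans u-j (trans y≡b (sym u-i)))))))
... | fixed p≢i p≢j e rewrite e =
      sym (transpose-fixed (λ q → p≢i (inj p i 1≤p p≤n 1≤i i≤n (trans q (sym u-i))))
                           (λ q → p≢j (inj p j 1≤p p≤n 1≤j j≤n (trans q (sym u-j)))))

Ascending : List ℕ → List ℕ → Set
Ascending u []      = ⊤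
Ascending u (a ∷ W) = at u a < at u (suc a) × Ascending (swapAdjacent u a) W

ascending-++⁻ : ∀ u W V → Ascending u (W ++ V) → Ascending u W × Ascending (applyWord u W) V
ascending-++⁻ u []      V asc         = tt , asc
ascending-++⁻ u (a ∷ W) V (lt , asc) =
  let (ascW , ascV) = ascending-++⁻ (swapAdjacent u a) W V asc in (lt , ascW) , ascV

ascending-++⁺ : ∀ u W V → Ascending u W → Ascending (applyWord u W) V → Ascending u (W ++ V)
ascending-++⁺ u []      V _           ascV = ascV
ascending-++⁺ u (a ∷ W) V (lt , ascW) ascV = lt , ascending-++⁺ (swapAdjacent u a) W V ascW ascV

inv-applyWord-ascending : ∀ u W → ValidWord (length u) W → Ascending u W → inv (applyWord u W) ≡ length W + inv u
inv-applyWord-ascending u []      _                     _          = refl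
inv-applyWord-ascending u (a ∷ W) ((1≤a , a<u) ∷ valid) (lt , asc) = begin
  inv (applyWord (swapAdjacent u a) W)       ≡⟨ inv-applyWord-ascending (swapAdjacent u a) W (validWord-cast (length-swapAdjacent u a) valid) asc ⟩
  length W + inv (swapAdjacent u a)          ≡⟨ cong (length W +_) (inv-swapAdjacent-ascent u a 1≤a a<u lt) ⟩
  length W + suc (inv u)                     ≡⟨ +-suc (length W) (inv u) ⟩
  suc (length W + inv u)                     ∎
  where open ≡-Reasoning

inv-applyWord-≤ : ∀ u W → ValidWord (length u) W → inv (applyWord u W) ≤ length W + inv u
inv-applyWord-≤ u []      _                     = ≤-refl
inv-applyWord-≤ u (a ∷ W) ((1≤a , a<u) ∷ valid) = begin
  inv (applyWord (swapAdjacent u a) W)       ≤⟨ inv-applyWord-≤ (swapAdjacent u a) W (validWord-cast (length-swapAdjacent u a) valid) ⟩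
  length W + inv (swapAdjacent u a)          ≤⟨ +-monoʳ-≤ (length W) (inv-swapAdjacent-≤ u a 1≤a a<u) ⟩
  length W + suc (inv u)                     ≡⟨ +-suc (length W) (inv u) ⟩
  suc (length W + inv u)                     ∎
  where open ≤-Reasoning

-- A letter that is not an ascent loses an inversion which the rest of the word cannot recover.
inv-applyWord-tight⇒ascending : ∀ n u W → length u ≡ n → ValidWord n W → InjectiveOn n u →
  inv (applyWord u W) ≡ length W + inv u → Ascending u W
inv-applyWord-tight⇒ascending n u []      u≡n _                      inj tight = tt
inv-applyWord-tight⇒ascending n u (a ∷ W) u≡n ((1≤a , a<n) ∷ valid) inj tight
  with <-cmp (at u a) (at u (suc a))
... | tri< lt _ _ =
  lt , inv-applyWord-tight⇒ascending n (swapAdjacent u a) W (trans (length-swapAdjacent u a) u≡n) valid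
         (swapAdjacent-injectiveOn n u a 1≤a a<n u≡n inj)
         (trans tight (trans (sym (+-suc (length W) (inv u)))
                             (cong (length W +_) (sym (inv-swapAdjacent-ascent u a 1≤a a<u lt)))))
  where
  a<u : suc a ≤ length u
  a<u = subst (suc a ≤_) (sym u≡n) a<n
... | tri≈ _ eq _ = ⊥-elim (1+n≢n (sym (inj a (suc a) 1≤a (<⇒≤ a<n) (s≤s z≤n) a<n eq)))
... | tri> _ _ gt = ⊥-elim (<-irrefl refl (begin-strict
  inv (applyWord (swapAdjacent u a) W)       ≤⟨ inv-applyWord-≤ (swapAdjacent u a) W (validWord-cast (trans (length-swapAdjacent u a) u≡n) valid) ⟩
  length W + inv (swapAdjacent u a)          <⟨ +-monoʳ-< (length W) (≤-reflexive (inv-swapAdjacent-descent u a 1≤a a<u gt)) ⟩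
  length W + inv u                           <⟨ n<1+n _ ⟩
  suc (length W + inv u)                     ≡⟨ tight ⟨
  inv (applyWord (swapAdjacent u a) W)       ∎))
  where
  open ≤-Reasoning
  a<u : suc a ≤ length u
  a<u = subst (suc a ≤_) (sym u≡n) a<n

-- The cycles s_{k+m−1} ⋯ s_{k+1} s_k

descWord : ℕ → ℕ → List ℕ
descWord k zero    = []
descWord k (suc m) = (k + m) ∷ descWord k m

⟦descWord⟧-start : ∀ k m → ⟦ descWord k m ⟧ k ≡ k + m
⟦descWord⟧-start k zero    = sym (+-identityʳ k)
⟦descWord⟧-start k (suc m) rewrite ⟦descWord⟧-start k m = trans (s-lower (k + m)) (sym (+-suc k m))

⟦descWord⟧-outside : ∀ k m p → p < k ⊎ k + m < p → ⟦ descWord k m ⟧ p ≡ p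
⟦descWord⟧-outside k zero    p _ = refl
⟦descWord⟧-outside k (suc m) p (inj₁ p<k) rewrite ⟦descWord⟧-outside k m p (inj₁ p<k) =
  s-below (<-≤-trans p<k (m≤m+n k m))
⟦descWord⟧-outside k (suc m) p (inj₂ k+m<p)
  rewrite ⟦descWord⟧-outside k m p (inj₂ (<-trans (+-monoʳ-< k (n<1+n m)) k+m<p)) =
  s-above (≤-trans (≤-reflexive (cong suc (sym (+-suc k m)))) k+m<p)

⟦descWord⟧-shift : ∀ k m q → k ≤ q → q < k + m → ⟦ descWord k m ⟧ (suc q) ≡ q
⟦descWord⟧-shift k zero q k≤q q<k+0 = ⊥-elim (<-irrefl refl (<-≤-trans (s≤s k≤q) (subst (suc q ≤_) (+-identityʳ k) q<k+0)))
⟦descWord⟧-shift k (suc m) q k≤q q<k+m+1 with m≤n⇒m<n∨m≡n (≤-pred (subst (suc q ≤_) (+-suc k m) q<k+m+1))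
... | inj₁ q<k+m rewrite ⟦descWord⟧-shift k m q k≤q q<k+m = s-below q<k+m
... | inj₂ refl rewrite ⟦descWord⟧-outside k m (suc (k + m)) (inj₂ ≤-refl) = s-upper (k + m)

descWord-valid : ∀ n k m → 1 ≤ k → k + m ≤ n → ValidWord n (descWord k m)
descWord-valid n k zero    _   _     = []
descWord-valid n k (suc m) 1≤k k+m<n =
  (≤-trans 1≤k (m≤m+n k m) , ≤-trans (≤-reflexive (sym (+-suc k m))) k+m<n)
  ∷ descWord-valid n k m 1≤k (≤-trans (+-monoʳ-≤ k (n≤1+n m)) k+m<n)

descWord-ascending : ∀ k m u → 1 ≤ k → k + m ≤ length u →
  (∀ q → k ≤ q → q < k + m → at u q < at u (k + m)) → Ascending u (descWord k m)
descWord-ascending k zero    u _   _     _       = tt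
descWord-ascending k (suc m) u 1≤k k+m<u smaller =
  subst (λ t → at u (k + m) < at u t) (+-suc k m) (smaller (k + m) (m≤m+n k m) (≤-reflexive (sym (+-suc k m)))) ,
  descWord-ascending k m (swapAdjacent u (k + m)) 1≤k
    (subst (k + m ≤_) (sym (length-swapAdjacent u (k + m))) (≤-trans (+-monoʳ-≤ k (n≤1+n m)) k+m<u))
    λ q k≤q q<k+m → subst₂ _<_
      (sym (trans (at-swapAdjacent u (k + m) q 1≤k+m k+m+1≤u) (cong (at u) (s-below q<k+m))))
      (sym (trans (at-swapAdjacent u (k + m) (k + m) 1≤k+m k+m+1≤u)
                  (cong (at u) (trans (s-lower (k + m)) (sym (+-suc k m))))))
      (smaller q k≤q (≤-trans q<k+m (+-monoʳ-≤ k (n≤1+n m))))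
  where
  1≤k+m : 1 ≤ k + m
  1≤k+m = ≤-trans 1≤k (m≤m+n k m)
  k+m+1≤u : suc (k + m) ≤ length u
  k+m+1≤u = ≤-trans (≤-reflexive (sym (+-suc k m))) k+m<u

-- Full rows of Pₙ and the longest element

rowWord : ℕ → ℕ → List ℕ
rowWord n j = descWord j (n ∸ j)

fullRowsWord : ℕ → ℕ → List ℕ
fullRowsWord n m = concatMap (rowWord n) (consecutive 1 m)

⟦fullRowsWord⟧-suc : ∀ n m p → ⟦ fullRowsWord n (suc m) ⟧ p ≡ ⟦ fullRowsWord n m ⟧ (⟦ rowWord n (suc m) ⟧ p)
⟦fullRowsWord⟧-suc n m p = begin
  ⟦ concatMap (rowWord n) (consecutive 1 (suc m)) ⟧ p
    ≡⟨ cong (λ l → ⟦ concatMap (rowWord n) l ⟧ p) (consecutive-snoc 1 m) ⟩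
  ⟦ concatMap (rowWord n) (consecutive 1 m ++ suc m ∷ []) ⟧ p
    ≡⟨ cong (λ l → ⟦ l ⟧ p) (concatMap-++ (rowWord n) (consecutive 1 m) (suc m ∷ [])) ⟩
  ⟦ fullRowsWord n m ++ rowWord n (suc m) ++ [] ⟧ p
    ≡⟨ ⟦⟧-++ (fullRowsWord n m) _ p ⟩
  ⟦ fullRowsWord n m ⟧ (⟦ rowWord n (suc m) ++ [] ⟧ p)
    ≡⟨ cong (λ l → ⟦ fullRowsWord n m ⟧ (⟦ l ⟧ p)) (++-identityʳ (rowWord n (suc m))) ⟩
  ⟦ fullRowsWord n m ⟧ (⟦ rowWord n (suc m) ⟧ p)
    ∎
  where open ≡-Reasoning

⟦fullRowsWord⟧-tail : ∀ n m t → 1 ≤ t → m + t ≤ n → ⟦ fullRowsWord n m ⟧ (m + t) ≡ t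
⟦fullRowsWord⟧-tail n zero    t _   _       = refl
⟦fullRowsWord⟧-tail n (suc m) t 1≤t m+t<n = begin
  ⟦ fullRowsWord n (suc m) ⟧ (suc m + t)                    ≡⟨ ⟦fullRowsWord⟧-suc n m (suc m + t) ⟩
  ⟦ fullRowsWord n m ⟧ (⟦ rowWord n (suc m) ⟧ (suc m + t))  ≡⟨ cong ⟦ fullRowsWord n m ⟧ shift ⟩
  ⟦ fullRowsWord n m ⟧ (m + t)                              ≡⟨ ⟦fullRowsWord⟧-tail n m t 1≤t (≤-trans (n≤1+n _) m+t<n) ⟩
  t                                                         ∎
  where
  open ≡-Reasoning
  shift : ⟦ rowWord n (suc m) ⟧ (suc m + t) ≡ m + t
  shift = ⟦descWord⟧-shift (suc m) (n ∸ suc m) (m + t) (≤-trans (≤-reflexive (+-comm 1 m)) (+-monoʳ-≤ m 1≤t))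
            (subst (suc (m + t) ≤_) (sym (m+[n∸m]≡n (≤-trans (m≤m+n (suc m) t) m+t<n))) m+t<n)

⟦fullRowsWord⟧-head : ∀ n m → m ≤ n → ∀ p → 1 ≤ p → p ≤ m → ⟦ fullRowsWord n m ⟧ p + p ≡ suc n
⟦fullRowsWord⟧-head n zero    _   (suc p) _ ()
⟦fullRowsWord⟧-head n (suc m) m<n p 1≤p p≤m+1 with m≤n⇒m<n∨m≡n p≤m+1
... | inj₁ p≤m = begin
  ⟦ fullRowsWord n (suc m) ⟧ p + p                   ≡⟨ cong (_+ p) (⟦fullRowsWord⟧-suc n m p) ⟩
  ⟦ fullRowsWord n m ⟧ (⟦ rowWord n (suc m) ⟧ p) + p ≡⟨ cong (λ q → ⟦ fullRowsWord n m ⟧ q + p) (⟦descWord⟧-outside (suc m) (n ∸ suc m) p (inj₁ p≤m)) ⟩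
  ⟦ fullRowsWord n m ⟧ p + p                         ≡⟨ ⟦fullRowsWord⟧-head n m (<⇒≤ m<n) p 1≤p (≤-pred p≤m) ⟩
  suc n                                              ∎
  where open ≡-Reasoning
... | inj₂ refl = begin
  ⟦ fullRowsWord n (suc m) ⟧ (suc m) + suc m                    ≡⟨ cong (_+ suc m) (⟦fullRowsWord⟧-suc n m (suc m)) ⟩
  ⟦ fullRowsWord n m ⟧ (⟦ rowWord n (suc m) ⟧ (suc m)) + suc m  ≡⟨ cong (λ q → ⟦ fullRowsWord n m ⟧ q + suc m) (⟦descWord⟧-start (suc m) (n ∸ suc m)) ⟩
  ⟦ fullRowsWord n m ⟧ (suc m + (n ∸ suc m)) + suc m            ≡⟨ cong (λ q → ⟦ fullRowsWord n m ⟧ q + suc m) (trans (m+[n∸m]≡n m<n) (sym (m+[n∸m]≡n (<⇒≤ m<n)))) ⟩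
  ⟦ fullRowsWord n m ⟧ (m + (n ∸ m)) + suc m                    ≡⟨ cong (_+ suc m) (⟦fullRowsWord⟧-tail n m (n ∸ m) (m<n⇒0<n∸m m<n) (≤-reflexive (m+[n∸m]≡n (<⇒≤ m<n)))) ⟩
  (n ∸ m) + suc m                                               ≡⟨ +-suc (n ∸ m) m ⟩
  suc (n ∸ m + m)                                               ≡⟨ cong suc (m∸n+n≡m (<⇒≤ m<n)) ⟩
  suc n                                                         ∎
  where open ≡-Reasoning

fullRowsWord-valid : ∀ n m → m ≤ n → ValidWord n (fullRowsWord n m)
fullRowsWord-valid n m m≤n = concat⁺ (map⁺ (all-consecutive 1 m λ j 1≤j j≤m →
  descWord-valid n j (n ∸ j) 1≤j (≤-reflexive (m+[n∸m]≡n (≤-trans (≤-pred j≤m) m≤n)))))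

countdown : ℕ → List ℕ
countdown zero    = []
countdown (suc m) = suc m ∷ countdown m

reverse-range : ∀ m → reverse (range m) ≡ countdown m
reverse-range zero    = refl
reverse-range (suc m) = begin
  reverse (range (suc m))                         ≡⟨ cong reverse (trans (range≡consecutive (suc m)) (consecutive-snoc 1 m)) ⟩
  reverse (consecutive 1 m ++ suc m ∷ [])         ≡⟨ reverse-++ (consecutive 1 m) (suc m ∷ []) ⟩
  suc m ∷ reverse (consecutive 1 m)               ≡⟨ cong (λ l → suc m ∷ reverse l) (range≡consecutive m) ⟨
  suc m ∷ reverse (range m)                       ≡⟨ cong (suc m ∷_) (reverse-range m) ⟩
  countdown (suc m)                               ∎
  where open ≡-Reasoning

length-countdown : ∀ m → length (countdown m) ≡ m
length-countdown zero    = refl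
length-countdown (suc m) = cong suc (length-countdown m)

at-countdown : ∀ m p → 1 ≤ p → p ≤ m → at (countdown m) p + p ≡ suc m
at-countdown (suc m) (suc zero)    _ _         = +-comm (suc m) 1
at-countdown (suc m) (suc (suc q)) _ (s≤s p≤m) =
  trans (+-suc (at (countdown m) (suc q)) (suc q)) (cong suc (at-countdown m (suc q) (s≤s z≤n) p≤m))

applyWord-fullRowsWord : ∀ n → applyWord (range n) (fullRowsWord n n) ≡ w₀ n
applyWord-fullRowsWord n = trans
  (at-ext _ (countdown n) (trans length-applied (sym (length-countdown n))) λ p 1≤p p≤ →
    let p≤n = subst (p ≤_) length-applied p≤ in
    +-cancelʳ-≡ p _ _ (begin
      at (applyWord (range n) (fullRowsWord n n)) p + p ≡⟨ cong (_+ p) (at-applyWord-range n (fullRowsWord n n) p valid 1≤p p≤n) ⟩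
      ⟦ fullRowsWord n n ⟧ p + p                        ≡⟨ ⟦fullRowsWord⟧-head n n ≤-refl p 1≤p p≤n ⟩
      suc n                                             ≡⟨ at-countdown n p 1≤p p≤n ⟨
      at (countdown n) p + p                            ∎))
  (sym (reverse-range n))
  where
  open ≡-Reasoning
  valid : ValidWord n (fullRowsWord n n)
  valid = fullRowsWord-valid n n ≤-refl
  length-applied : length (applyWord (range n) (fullRowsWord n n)) ≡ n
  length-applied = trans (length-applyWord (range n) (fullRowsWord n n)) (length-range n)

∸≡suc∸suc : ∀ {a n} → a < n → n ∸ a ≡ suc (n ∸ suc a)
∸≡suc∸suc {zero}  {suc n} _         = refl
∸≡suc∸suc {suc a} {suc n} (s≤s a<n) = ∸≡suc∸suc a<n

≤∸⇒+≤ : ∀ j n a → a ≤ n ∸ j → 1 ≤ a → j + a ≤ n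
≤∸⇒+≤ zero    n       a a≤n∸j _   = a≤n∸j
≤∸⇒+≤ (suc j) zero    a a≤0   1≤a = ⊥-elim (<-irrefl refl (≤-trans 1≤a a≤0))
≤∸⇒+≤ (suc j) (suc n) a a≤n∸j 1≤a = s≤s (≤∸⇒+≤ j n a a≤n∸j 1≤a)

+≤⇒≤∸ : ∀ k b n → k + b ≤ n → b ≤ n ∸ k
+≤⇒≤∸ k b n k+b≤n = m+n≤o⇒m≤o∸n b (subst (_≤ n) (+-comm k b) k+b≤n)

all-countdown : ∀ {P : ℕ → Set} m → (∀ x → 1 ≤ x → x ≤ m → P x) → All P (countdown m)
all-countdown zero    _ = []
all-countdown (suc m) h = h (suc m) (s≤s z≤n) ≤-refl ∷ all-countdown m (λ x 1≤x x≤m → h x 1≤x (m≤n⇒m≤1+n x≤m))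

filterᵇ-accept : ∀ (R : Subset) {x} xs → R x ≡ true → filterᵇ R (x ∷ xs) ≡ x ∷ filterᵇ R xs
filterᵇ-accept R xs Rx = filter-accept (T? ∘ R) (subst T (sym Rx) tt)

filterᵇ-reject : ∀ (R : Subset) {x} xs → R x ≡ false → filterᵇ R (x ∷ xs) ≡ filterᵇ R xs
filterᵇ-reject R xs Rx = filter-reject (T? ∘ R) (subst T Rx)

filterᵇ-all : ∀ (R : Subset) {xs} → All (λ p → R p ≡ true) xs → filterᵇ R xs ≡ xs
filterᵇ-all R all = filter-all (T? ∘ R) (All.map (λ Rp → subst T (sym Rp) tt) all)

filterᵇ-cong : ∀ (R R′ : Subset) xs → All (λ p → R p ≡ R′ p) xs → filterᵇ R xs ≡ filterᵇ R′ xs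
filterᵇ-cong R R′ []       []           = refl
filterᵇ-cong R R′ (x ∷ xs) (Rx≡R′x ∷ h) with R x | R′ x
filterᵇ-cong R R′ (x ∷ xs) (refl ∷ h) | true  | true  = cong (x ∷_) (filterᵇ-cong R R′ xs h)
filterᵇ-cong R R′ (x ∷ xs) (refl ∷ h) | false | false = filterᵇ-cong R R′ xs h

filterᵇ-concatMap : ∀ (R : Subset) (f : ℕ → List (ℕ × ℕ)) xs →
  filterᵇ R (concatMap f xs) ≡ concatMap (filterᵇ R ∘ f) xs
filterᵇ-concatMap R f []       = refl
filterᵇ-concatMap R f (x ∷ xs) =
  trans (filter-++ (T? ∘ R) (f x) (concatMap f xs)) (cong (filterᵇ R (f x) ++_) (filterᵇ-concatMap R f xs))

filterᵇ-complete : ∀ (R : Subset) xs → length (filterᵇ R xs) ≡ length xs → All (λ p → R p ≡ true) xs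
filterᵇ-complete R xs eq =
  All.map (Equivalence.to T-≡) (subst (All (T ∘ R)) (filter-complete (T? ∘ R) eq) (all-filter (T? ∘ R) xs))

insert-self : ∀ k b (R : Subset) → insert (k , b) R (k , b) ≡ true
insert-self k b R rewrite ≡ᵇ-refl k | ≡ᵇ-refl b = refl

insert-otherRow : ∀ k b (R : Subset) j a → j ≢ k → insert (k , b) R (j , a) ≡ R (j , a)
insert-otherRow k b R j a j≢k rewrite ≢⇒≡ᵇ-false j≢k = refl

insert-otherColumn : ∀ k b (R : Subset) j a → a ≢ b → insert (k , b) R (j , a) ≡ R (j , a)
insert-otherColumn k b R j a a≢b rewrite ≢⇒≡ᵇ-false a≢b | ∧-zeroʳ (j ≡ᵇ k) = refl

insert-⊇ : ∀ q (R : Subset) p → R p ≡ true → insert q R p ≡ true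
insert-⊇ (k , b) R (j , a) Rp rewrite Rp = ∨-zeroʳ ((j ≡ᵇ k) ∧ (a ≡ᵇ b))

-- The word d(R), row by row

rcRow : ℕ → ℕ → List (ℕ × ℕ)
rcRow n k = map (k ,_) (countdown (n ∸ k))

PnRC≡rcRows : ∀ n → PnRC n ≡ concatMap (rcRow n) (consecutive 1 n)
PnRC≡rcRows n = trans (concatMap-cong (λ k → cong (map (k ,_)) (reverse-range (n ∸ k))) (range n))
                      (cong (concatMap (rcRow n)) (range≡consecutive n))

letter : ℕ × ℕ → ℕ
letter (k , b) = k + b ∸ 1

presentRow : ℕ → Subset → ℕ → List (ℕ × ℕ)
presentRow n R k = filterᵇ R (rcRow n k)

d≡rowLetters : ∀ n R → d n R ≡ map letter (concatMap (presentRow n R) (consecutive 1 n))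
d≡rowLetters n R = begin
  d n R                                                         ≡⟨ map-cong (λ { (k , b) → refl }) (filterᵇ R (PnRC n)) ⟩
  map letter (filterᵇ R (PnRC n))                               ≡⟨ cong (map letter ∘ filterᵇ R) (PnRC≡rcRows n) ⟩
  map letter (filterᵇ R (concatMap (rcRow n) (consecutive 1 n))) ≡⟨ cong (map letter) (filterᵇ-concatMap R (rcRow n) (consecutive 1 n)) ⟩
  map letter (concatMap (presentRow n R) (consecutive 1 n))     ∎
  where open ≡-Reasoning

letters-rowSegment : ∀ j L → map letter (map (j ,_) (countdown L)) ≡ descWord j L
letters-rowSegment j zero    = refl
letters-rowSegment j (suc L) = cong₂ _∷_ (cong (_∸ 1) (+-suc j L)) (letters-rowSegment j L)

letter-bounds : ∀ n j → All (λ p → j ≤ letter p × letter p < n) (rcRow n j)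
letter-bounds n j = map⁺ (all-countdown (n ∸ j) λ a 1≤a a≤ → bounds a 1≤a (≤∸⇒+≤ j n a a≤ 1≤a))
  where
  bounds : ∀ a → 1 ≤ a → j + a ≤ n → j ≤ j + a ∸ 1 × j + a ∸ 1 < n
  bounds (suc a) _ j+a<n = subst (λ t → j ≤ t ∸ 1 × t ∸ 1 < n) (sym (+-suc j a))
                             (m≤m+n j a , ≤-trans (≤-reflexive (sym (+-suc j a))) j+a<n)

concatMap-cong-consecutive : ∀ {B : Set} {f g : ℕ → List B} a m → (∀ j → a ≤ j → j < a + m → f j ≡ g j) →
  concatMap f (consecutive a m) ≡ concatMap g (consecutive a m)
concatMap-cong-consecutive a m f≗g = cong concat (map-cong-local (all-consecutive a m f≗g))

d-splitAtRow : ∀ n k₀ R → suc k₀ ≤ n →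
  d n R ≡ map letter (concatMap (presentRow n R) (consecutive 1 k₀)) ++
    (map letter (presentRow n R (suc k₀)) ++ map letter (concatMap (presentRow n R) (consecutive (suc (suc k₀)) (n ∸ suc k₀))))
d-splitAtRow n k₀ R k₀<n = begin
  d n R
    ≡⟨ d≡rowLetters n R ⟩
  map letter (concatMap row (consecutive 1 n))
    ≡⟨ cong (map letter ∘ concatMap row) rows ⟩
  map letter (concatMap row (consecutive 1 k₀ ++ suc k₀ ∷ later))
    ≡⟨ cong (map letter) (concatMap-++ row (consecutive 1 k₀) (suc k₀ ∷ later)) ⟩
  map letter (concatMap row (consecutive 1 k₀) ++ row (suc k₀) ++ concatMap row later)
    ≡⟨ map-++ letter (concatMap row (consecutive 1 k₀)) _ ⟩
  map letter (concatMap row (consecutive 1 k₀)) ++ map letter (row (suc k₀) ++ concatMap row later)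
    ≡⟨ cong (map letter (concatMap row (consecutive 1 k₀)) ++_) (map-++ letter (row (suc k₀)) _) ⟩
  map letter (concatMap row (consecutive 1 k₀)) ++ (map letter (row (suc k₀)) ++ map letter (concatMap row later))
    ∎
  where
  open ≡-Reasoning
  row : ℕ → List (ℕ × ℕ)
  row = presentRow n R
  later : List ℕ
  later = consecutive (suc (suc k₀)) (n ∸ suc k₀)
  rows : consecutive 1 n ≡ consecutive 1 k₀ ++ suc k₀ ∷ later
  rows = trans (cong (consecutive 1) (sym (m+[n∸m]≡n (<⇒≤ k₀<n))))
           (trans (consecutive-++ 1 k₀ (n ∸ k₀)) (cong (λ t → consecutive 1 k₀ ++ consecutive (suc k₀) t) (∸≡suc∸suc k₀<n)))

ContainsLexBelow : ℕ → Subset → ℕ × ℕ → Set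
ContainsLexBelow n R p = ∀ q → InPn n q → q <lex p → R q ≡ true

fullRows-letters : ∀ n k₀ R → (∀ j a → 1 ≤ j → j ≤ k₀ → 1 ≤ a → j + a ≤ n → R (j , a) ≡ true) →
  map letter (concatMap (presentRow n R) (consecutive 1 k₀)) ≡ fullRowsWord n k₀
fullRows-letters n k₀ R full = begin
  map letter (concatMap (presentRow n R) (consecutive 1 k₀))            ≡⟨ map-concatMap letter (presentRow n R) (consecutive 1 k₀) ⟩
  concatMap (map letter ∘ presentRow n R) (consecutive 1 k₀)            ≡⟨ concatMap-cong-consecutive 1 k₀ row ⟩
  fullRowsWord n k₀                                                     ∎
  where
  open ≡-Reasoning
  row : ∀ j → 1 ≤ j → j < 1 + k₀ → map letter (presentRow n R j) ≡ rowWord n j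
  row j 1≤j j≤k₀ = trans
    (cong (map letter) (filterᵇ-all R (map⁺ (all-countdown (n ∸ j) λ a 1≤a a≤ →
       full j a 1≤j (≤-pred j≤k₀) 1≤a (≤∸⇒+≤ j n a a≤ 1≤a)))))
    (letters-rowSegment j (n ∸ j))

countdownAbove : ℕ → ℕ → List ℕ
countdownAbove zero    b = []
countdownAbove (suc s) b = suc (s + b) ∷ countdownAbove s b

countdown-+ : ∀ s b → countdown (s + b) ≡ countdownAbove s b ++ countdown b
countdown-+ zero    b = refl
countdown-+ (suc s) b = cong (suc (s + b) ∷_) (countdown-+ s b)

all-countdownAbove : ∀ {P : ℕ → Set} s b → (∀ x → b < x → x ≤ s + b → P x) → All P (countdownAbove s b)
all-countdownAbove zero    b _ = []
all-countdownAbove (suc s) b h = h (suc (s + b)) (s≤s (m≤n+m b s)) ≤-refl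
  ∷ all-countdownAbove s b (λ x b<x x≤ → h x b<x (m≤n⇒m≤1+n x≤))

record RowInsertion (n k b₀ : ℕ) (R : Subset) : Set where
  field
    rowHigh        : List ℕ
    rowHigh-ok     : All (λ a → k + suc b₀ ≤ a × a < n) rowHigh
    letters-before : map letter (presentRow n R k) ≡ rowHigh ++ descWord k b₀
    letters-after  : map letter (presentRow n (insert (k , suc b₀) R) k) ≡ rowHigh ++ descWord k (suc b₀)

row-insert : ∀ n k b₀ (R : Subset) → k + suc b₀ ≤ n →
  (∀ a → 1 ≤ a → a ≤ b₀ → R (k , a) ≡ true) → R (k , suc b₀) ≡ false → RowInsertion n k b₀ R
row-insert n k b₀ R k+b≤n present absent = record
  { rowHigh = map letter high ; rowHigh-ok = high-bounds ; letters-before = letters-R ; letters-after = letters-R′ }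
  where
  b s : ℕ
  b = suc b₀
  s = n ∸ k ∸ b
  R′ : Subset
  R′ = insert (k , b) R
  s+b≡ : s + b ≡ n ∸ k
  s+b≡ = m∸n+n≡m (+≤⇒≤∸ k b n k+b≤n)
  above below high : List (ℕ × ℕ)
  above = map (k ,_) (countdownAbove s b)
  below = map (k ,_) (countdown b₀)
  high = filterᵇ R above
  row≡ : rcRow n k ≡ above ++ (k , b) ∷ below
  row≡ = trans (cong (map (k ,_) ∘ countdown) (sym s+b≡))
           (trans (cong (map (k ,_)) (countdown-+ s b)) (map-++ (k ,_) (countdownAbove s b) (countdown b)))
  below-R : All (λ p → R p ≡ true) below
  below-R = map⁺ (all-countdown b₀ present)
  presentRow-R : presentRow n R k ≡ high ++ below
  presentRow-R = begin
    filterᵇ R (rcRow n k)                       ≡⟨ cong (filterᵇ R) row≡ ⟩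
    filterᵇ R (above ++ (k , b) ∷ below)        ≡⟨ filter-++ (T? ∘ R) above _ ⟩
    high ++ filterᵇ R ((k , b) ∷ below)         ≡⟨ cong (high ++_) (filterᵇ-reject R below absent) ⟩
    high ++ filterᵇ R below                     ≡⟨ cong (high ++_) (filterᵇ-all R below-R) ⟩
    high ++ below                               ∎
    where open ≡-Reasoning
  presentRow-R′ : presentRow n R′ k ≡ high ++ (k , b) ∷ below
  presentRow-R′ = begin
    filterᵇ R′ (rcRow n k)                      ≡⟨ cong (filterᵇ R′) row≡ ⟩
    filterᵇ R′ (above ++ (k , b) ∷ below)       ≡⟨ filter-++ (T? ∘ R′) above _ ⟩
    filterᵇ R′ above ++ filterᵇ R′ ((k , b) ∷ below)
      ≡⟨ cong₂ _++_ (filterᵇ-cong R′ R above (map⁺ (all-countdownAbove s b λ x b<x _ →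
                        insert-otherColumn k b R k x (≢-sym (<⇒≢ b<x)))))
                    (filterᵇ-accept R′ below (insert-self k b R)) ⟩
    high ++ (k , b) ∷ filterᵇ R′ below          ≡⟨ cong (λ l → high ++ (k , b) ∷ l) (filterᵇ-all R′ (All.map (insert-⊇ (k , b) R _) below-R)) ⟩
    high ++ (k , b) ∷ below                     ∎
    where open ≡-Reasoning
  letters-R : map letter (presentRow n R k) ≡ map letter high ++ descWord k b₀
  letters-R = trans (cong (map letter) presentRow-R)
                (trans (map-++ letter high below) (cong (map letter high ++_) (letters-rowSegment k b₀)))
  letters-R′ : map letter (presentRow n R′ k) ≡ map letter high ++ descWord k b
  letters-R′ = trans (cong (map letter) presentRow-R′)
                 (trans (map-++ letter high _) (cong (map letter high ++_) (letters-rowSegment k b)))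
  high-bounds : All (λ a → k + b ≤ a × a < n) (map letter high)
  high-bounds = map⁺ (filter⁺ (T? ∘ R) (map⁺ (all-countdownAbove s b bounds)))
    where
    bounds : ∀ x → b < x → x ≤ s + b → k + b ≤ letter (k , x) × letter (k , x) < n
    bounds (suc x) (s≤s b≤x) x<s+b rewrite +-suc k x =
      +-monoʳ-≤ k b≤x ,
      ≤-trans (≤-reflexive (sym (+-suc k x)))
        (≤-trans (+-monoʳ-≤ k (≤-trans x<s+b (≤-reflexive s+b≡))) (≤-reflexive (m+[n∸m]≡n (≤-trans (m≤m+n k b) k+b≤n))))

record InsertionSplit (n k₀ b₀ : ℕ) (R : Subset) : Set where
  field
    high      : List ℕ
    later     : List ℕ
    high-ok   : All (λ a → suc k₀ + suc b₀ ≤ a × a < n) high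
    later-ok  : All (λ a → suc k₀ < a × a < n) later
    d-before  : d n R ≡ fullRowsWord n k₀ ++ high ++ descWord (suc k₀) b₀ ++ later
    d-after   : d n (insert (suc k₀ , suc b₀) R) ≡ fullRowsWord n k₀ ++ high ++ descWord (suc k₀) (suc b₀) ++ later

insertionSplit : ∀ n k₀ b₀ (R : Subset) → suc k₀ + suc b₀ ≤ n →
  ContainsLexBelow n R (suc k₀ , suc b₀) → R (suc k₀ , suc b₀) ≡ false → InsertionSplit n k₀ b₀ R
insertionSplit n k₀ b₀ R k+b≤n below absent = record
  { high = rowHigh ; later = map letter laterPairs ; high-ok = rowHigh-ok ; later-ok = later-ok
  ; d-before = trans (d-splitAtRow n k₀ R k≤n)
                 (cong₂ _++_ (fullRows-letters n k₀ R earlier)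
                   (trans (cong (_++ map letter laterPairs) letters-before) (++-assoc rowHigh (descWord k b₀) _)))
  ; d-after  = trans (d-splitAtRow n k₀ R′ k≤n)
                 (cong₂ _++_ (fullRows-letters n k₀ R′ (λ j a 1≤j j≤k₀ 1≤a j+a≤n → insert-⊇ (k , b) R (j , a) (earlier j a 1≤j j≤k₀ 1≤a j+a≤n)))
                   (trans (cong₂ _++_ letters-after later-unchanged) (++-assoc rowHigh (descWord k (suc b₀)) _)))
  }
  where
  k b : ℕ
  k = suc k₀
  b = suc b₀
  R′ : Subset
  R′ = insert (k , b) R
  k≤n : k ≤ n
  k≤n = ≤-trans (m≤m+n k b) k+b≤n
  earlier : ∀ j a → 1 ≤ j → j ≤ k₀ → 1 ≤ a → j + a ≤ n → R (j , a) ≡ true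
  earlier j a 1≤j j≤k₀ 1≤a j+a≤n = below (j , a) (1≤j , 1≤a , j+a≤n) (inj₁ (s≤s j≤k₀))
  present : ∀ a → 1 ≤ a → a ≤ b₀ → R (k , a) ≡ true
  present a 1≤a a≤b₀ = below (k , a) (s≤s z≤n , 1≤a , ≤-trans (+-monoʳ-≤ k (m≤n⇒m≤1+n a≤b₀)) k+b≤n) (inj₂ (refl , s≤s a≤b₀))
  open RowInsertion (row-insert n k b₀ R k+b≤n present absent)
  laterRows : List ℕ
  laterRows = consecutive (suc k) (n ∸ k)
  laterPairs : List (ℕ × ℕ)
  laterPairs = concatMap (presentRow n R) laterRows
  later-ok : All (λ a → k < a × a < n) (map letter laterPairs)
  later-ok = map⁺ (concat⁺ (map⁺ (all-consecutive (suc k) (n ∸ k) λ j k<j _ →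
    filter⁺ (T? ∘ R) (All.map (λ (j≤ , <n) → <-≤-trans k<j j≤ , <n) (letter-bounds n j)))))
  later-unchanged : map letter (concatMap (presentRow n R′) laterRows) ≡ map letter laterPairs
  later-unchanged = cong (map letter) (concatMap-cong-consecutive (suc k) (n ∸ k) λ j k<j _ →
    filterᵇ-cong R′ R (rcRow n j) (map⁺ (all-countdown (n ∸ j) λ a _ _ → insert-otherRow k b R j a (≢-sym (<⇒≢ k<j)))))

-- Exchanging two values

s-<-cases : ∀ a x z → x < s[ a ] z → s[ a ] x < z ⊎ (x ≡ a × z ≡ a)
s-<-cases a x z x<sz with transpose-case a (suc a) z
... | moved-left refl e rewrite e with m≤n⇒m<n∨m≡n (≤-pred x<sz)
...   | inj₁ x<a  = inj₁ (subst (_< z) (sym (s-below x<a)) x<a)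
...   | inj₂ refl = inj₂ (refl , refl)
s-<-cases a x z x<sz | moved-right _ refl e rewrite e =
  inj₁ (subst (_< suc a) (sym (s-below x<sz)) (m<n⇒m<1+n x<sz))
s-<-cases a x z x<sz | fixed _ z≢a+1 e rewrite e with transpose-case a (suc a) x
... | moved-left refl e′ rewrite e′ = inj₁ (≤∧≢⇒< x<sz (z≢a+1 ∘ sym))
... | moved-right _ refl e′ rewrite e′ = inj₁ (<-trans (n<1+n a) x<sz)
... | fixed _ _ e′ rewrite e′ = inj₁ x<sz

module ValueTransposition (n k b y : ℕ) (1≤k : 1 ≤ k) (b<y : b < y) where

  record Invariant (u u′ : List ℕ) : Set where
    field
      length-u    : length u ≡ n
      length-u′   : length u′ ≡ n
      injective   : InjectiveOn n u′
      transposed  : ∀ p → 1 ≤ p → p ≤ n → at u p ≡ transpose b y (at u′ p)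
      at-k        : at u′ k ≡ b
      j           : ℕ
      k<j         : k < j
      j≤n         : j ≤ n
      at-j        : at u′ j ≡ y
      between⇒>j  : ∀ q → k < q → q ≤ n → b < at u′ q → at u′ q < y → j < q

  y≢b : y ≢ b
  y≢b = ≢-sym (<⇒≢ b<y)

  module _ {u u′ : List ℕ} (I : Invariant u u′) {a : ℕ} (k<a : k < a) (a<n : suc a ≤ n)
           (asc : at u′ a < at u′ (suc a)) where
    open Invariant I

    private
      1≤a : 1 ≤ a
      1≤a = ≤-trans 1≤k (<⇒≤ k<a)
      a≤n : a ≤ n
      a≤n = <⇒≤ a<n
      k≤n : k ≤ n
      k≤n = ≤-trans (<⇒≤ k<a) a≤n
      at-a≢b : at u′ a ≢ b
      at-a≢b e = <-irrefl (injective k a 1≤k k≤n 1≤a a≤n (trans at-k (sym e))) k<a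
      at-a+1≢b : at u′ (suc a) ≢ b
      at-a+1≢b e = <-irrefl (injective k (suc a) 1≤k k≤n (s≤s z≤n) a<n (trans at-k (sym e))) (m<n⇒m<1+n k<a)

    ascent-transfers : at u a < at u (suc a)
    ascent-transfers with at u′ a ≟ y
    ... | yes at-a≡y = subst₂ _<_
          (sym (trans (transposed a 1≤a a≤n) (trans (cong (transpose b y) at-a≡y) (transpose-right y≢b))))
          (sym (trans (transposed (suc a) (s≤s z≤n) a<n)
                      (transpose-fixed at-a+1≢b (λ e → <-irrefl (sym (trans e (sym at-a≡y))) asc))))
          (<-trans b<y (subst (_< at u′ (suc a)) at-a≡y asc))
    ... | no at-a≢y with at u′ (suc a) ≟ y
    ...   | no at-a+1≢y = subst₂ _<_
            (sym (trans (transposed a 1≤a a≤n) (transpose-fixed at-a≢b at-a≢y)))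
            (sym (trans (transposed (suc a) (s≤s z≤n) a<n) (transpose-fixed at-a+1≢b at-a+1≢y)))
            asc
    ...   | yes at-a+1≡y = subst₂ _<_
            (sym (trans (transposed a 1≤a a≤n) (transpose-fixed at-a≢b at-a≢y)))
            (sym (trans (transposed (suc a) (s≤s z≤n) a<n) (trans (cong (transpose b y) at-a+1≡y) (transpose-right y≢b))))
            at-a<b
      where
      -- otherwise u′(a) would lie strictly between b and y after position k but before j = a+1
      at-a<b : at u′ a < b
      at-a<b with <-cmp (at u′ a) b
      ... | tri< lt _ _ = lt
      ... | tri≈ _ eq _ = ⊥-elim (at-a≢b eq)
      ... | tri> _ _ gt = ⊥-elim (<-irrefl refl (<-trans (n<1+n a) (subst (_< a) j≡a+1 j<a)))
        where
        j<a : j < a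
        j<a = between⇒>j a k<a a≤n gt (subst (at u′ a <_) at-a+1≡y asc)
        j≡a+1 : j ≡ suc a
        j≡a+1 = injective j (suc a) (≤-trans 1≤k (<⇒≤ k<j)) j≤n (s≤s z≤n) a<n (trans at-j (sym at-a+1≡y))

    invariant-step : Invariant (swapAdjacent u a) (swapAdjacent u′ a)
    invariant-step = record
      { length-u   = trans (length-swapAdjacent u a) length-u
      ; length-u′  = trans (length-swapAdjacent u′ a) length-u′
      ; injective  = swapAdjacent-injectiveOn n u′ a 1≤a a<n length-u′ injective
      ; transposed = λ p 1≤p p≤n → let (1≤sp , sp≤n) = s-preserves-interval a 1 n p 1≤a a<n 1≤p p≤n in
          trans (at-swapAdjacent u a p 1≤a a<u)
            (trans (transposed (s[ a ] p) 1≤sp sp≤n) (cong (transpose b y) (sym (at-swapAdjacent u′ a p 1≤a a<u′))))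
      ; at-k       = trans (at-swapAdjacent u′ a k 1≤a a<u′) (trans (cong (at u′) (s-below k<a)) at-k)
      ; j          = s[ a ] j
      ; k<j        = proj₁ (s-preserves-interval a (suc k) n j k<a a<n k<j j≤n)
      ; j≤n        = proj₂ (s-preserves-interval a (suc k) n j k<a a<n k<j j≤n)
      ; at-j       = trans (at-swapAdjacent u′ a (s[ a ] j) 1≤a a<u′) (trans (cong (at u′) (transpose-involutive a (suc a) j)) at-j)
      ; between⇒>j = λ q k<q q≤n b<q q<y → between⇒>j′ q k<q q≤n
          (subst (b <_) (at-swapAdjacent u′ a q 1≤a a<u′) b<q) (subst (_< y) (at-swapAdjacent u′ a q 1≤a a<u′) q<y)
      }
      where
      a<u : suc a ≤ length u
      a<u = subst (suc a ≤_) (sym length-u) a<n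
      a<u′ : suc a ≤ length u′
      a<u′ = subst (suc a ≤_) (sym length-u′) a<n
      between⇒>j′ : ∀ q → k < q → q ≤ n → b < at u′ (s[ a ] q) → at u′ (s[ a ] q) < y → s[ a ] j < q
      between⇒>j′ q k<q q≤n b<q q<y
        with s-<-cases a j q (between⇒>j (s[ a ] q) (proj₁ (s-preserves-interval a (suc k) n q k<a a<n k<q q≤n))
                                                    (proj₂ (s-preserves-interval a (suc k) n q k<a a<n k<q q≤n)) b<q q<y)
      ... | inj₁ lt = lt
      ... | inj₂ (refl , refl) =
        ⊥-elim (<-irrefl refl (<-trans (subst (_< at u′ (suc j)) at-j asc) (subst (_< y) (cong (at u′) (s-lower j)) q<y)))

  invariant-along : ∀ W {u u′} → All (λ a → k < a × a < n) W → Invariant u u′ → Ascending u′ W →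
    Ascending u W × Invariant (applyWord u W) (applyWord u′ W)
  invariant-along []      _                   I _            = tt , I
  invariant-along (a ∷ W) ((k<a , a<n) ∷ inW) I (asc , ascW) =
    let (ascW′ , I′) = invariant-along W inW (invariant-step I k<a a<n asc) ascW
    in (ascent-transfers I k<a a<n asc , ascW′) , I′

  invariant⇒labeledCover : ∀ {v w′} → Invariant v w′ → LabeledCover n w′ (k , b) v
  invariant⇒labeledCover {v} {w′} I =
    k , j , (1≤k , k<j , j≤n , v≡ , at-k<at-j , nothing-between) , ≤-refl , k<j , sym at-k ,
    sym (trans (transposed j 1≤j j≤n) (trans (cong (transpose b y) at-j) (transpose-right y≢b)))
    where
    open Invariant I
    1≤j : 1 ≤ j
    1≤j = ≤-trans 1≤k (<⇒≤ k<j)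
    k≤n : k ≤ n
    k≤n = ≤-trans (<⇒≤ k<j) j≤n
    at-k<at-j : at w′ k < at w′ j
    at-k<at-j = subst₂ _<_ (sym at-k) (sym at-j) b<y
    nothing-between : ∀ i → k < i → i < j → ¬ (at w′ k < at w′ i × at w′ i < at w′ j)
    nothing-between i k<i i<j (k<i′ , i<j′) = <-irrefl refl (<-trans i<j
      (between⇒>j i k<i (≤-trans (<⇒≤ i<j) j≤n) (subst (_< at w′ i) at-k k<i′) (subst (at w′ i <_) at-j i<j′)))
    at-v : ∀ p → 1 ≤ p → p ≤ n → at v p ≡ at w′ (transpose k j p)
    at-v p 1≤p p≤n = trans (transposed p 1≤p p≤n) (sym (at-transpose n w′ injective 1≤k k≤n 1≤j j≤n at-k at-j p 1≤p p≤n))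
    v≡ : v ≡ swapAt w′ k j
    v≡ = at-ext v (swapAt w′ k j) (trans length-u (sym (trans (length-swapAt w′ k j) length-u′)))
           (λ p 1≤p p≤v → let p≤n = subst (p ≤_) length-u p≤v in
              trans (at-v p 1≤p p≤n) (sym (at-swapAt w′ k j p 1≤p (subst (p ≤_) (sym length-u′) p≤n))))

-- One step of the chain

module InsertionStep (n k₀ b₀ : ℕ) (R : Subset) (k+b≤n : suc k₀ + suc b₀ ≤ n)
                     (below : ContainsLexBelow n R (suc k₀ , suc b₀)) (absent : R (suc k₀ , suc b₀) ≡ false) where

  k b : ℕ
  k = suc k₀
  b = suc b₀

  R′ : Subset
  R′ = insert (k , b) R

  open InsertionSplit (insertionSplit n k₀ b₀ R k+b≤n below absent)

  P B B′ : List ℕ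
  P  = fullRowsWord n k₀
  B  = descWord k b₀
  B′ = descWord k b

  k+b₀≤n : k + b₀ ≤ n
  k+b₀≤n = ≤-trans (+-monoʳ-≤ k (n≤1+n b₀)) k+b≤n

  P-valid : ValidWord n P
  P-valid = fullRowsWord-valid n k₀ (≤-trans (≤-trans (n≤1+n k₀) (m≤m+n k b)) k+b≤n)

  high-valid : ValidWord n high
  high-valid = All.map (λ (k+b≤a , a<n) → ≤-trans (s≤s z≤n) k+b≤a , a<n) high-ok

  later-valid : ValidWord n later
  later-valid = All.map (λ (k<a , a<n) → ≤-trans (s≤s z≤n) k<a , a<n) later-ok

  d-valid : ValidWord n (d n R)
  d-valid = subst (ValidWord n) (sym d-before)
    (++⁺ P-valid (++⁺ high-valid (++⁺ (descWord-valid n k b₀ (s≤s z≤n) k+b₀≤n) later-valid)))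

  d′-valid : ValidWord n (d n R′)
  d′-valid = subst (ValidWord n) (sym d-after)
    (++⁺ P-valid (++⁺ high-valid (++⁺ (descWord-valid n k b (s≤s z≤n) k+b≤n) later-valid)))

  length-d′ : length (d n R′) ≡ suc (length (d n R))
  length-d′ = trans (cong length d-after)
    (trans (length-++-++-∷ P high (k + b₀) (B ++ later)) (cong (suc ∘ length) (sym d-before)))

  x : List ℕ
  x = applyWord (applyWord (range n) P) high

  length-x : length x ≡ n
  length-x = trans (length-applyWord _ high) (trans (length-applyWord (range n) P) (length-range n))

  x-injective : InjectiveOn n x
  x-injective = applyWord-injectiveOn n _ high (trans (length-applyWord (range n) P) (length-range n)) high-valid
                  (applyWord-injectiveOn n (range n) P (length-range n) P-valid (range-injectiveOn n))

  wOf-via-x : ∀ (T : Subset) C → d n T ≡ P ++ high ++ C ++ later → ValidWord n (d n T) →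
    wOf n T ≡ applyWord (applyWord x C) later
  wOf-via-x T C d≡ valid = begin
    wOf n T                                              ≡⟨ prod≡applyWord n (d n T) valid ⟩
    applyWord (range n) (d n T)                          ≡⟨ cong (applyWord (range n)) d≡ ⟩
    applyWord (range n) (P ++ high ++ C ++ later)        ≡⟨ foldl-++ swapAdjacent (range n) P _ ⟩
    applyWord (applyWord (range n) P) (high ++ C ++ later) ≡⟨ foldl-++ swapAdjacent _ high _ ⟩
    applyWord x (C ++ later)                             ≡⟨ foldl-++ swapAdjacent x C later ⟩
    applyWord (applyWord x C) later                      ∎
    where open ≡-Reasoning

  at-x : ∀ p → 1 ≤ p → p ≤ n → at x p ≡ ⟦ P ⟧ (⟦ high ⟧ p)
  at-x p 1≤p p≤n = let (1≤q , q≤n) = ⟦⟧-preserves-interval 1 n high p high-valid 1≤p p≤n in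
    trans (at-applyWord _ high p (validWord-cast (trans (length-applyWord (range n) P) (length-range n)) high-valid))
          (at-applyWord-range n P (⟦ high ⟧ p) P-valid 1≤q q≤n)

  -- Rows 1, …, k₀ are full and high only moves positions ≥ k+b, so x reads 1, 2, …, b on positions k, …, k+b₀.
  x-block : ∀ q → k ≤ q → q < k + b → at x q ≡ suc (q ∸ k)
  x-block q k≤q q<k+b = begin
    at x q                                 ≡⟨ at-x q (≤-trans (s≤s z≤n) k≤q) (≤-trans (<⇒≤ q<k+b) k+b≤n) ⟩
    ⟦ P ⟧ (⟦ high ⟧ q)                     ≡⟨ cong ⟦ P ⟧ (⟦⟧-fixes-below (k + b) n high q high-ok q<k+b) ⟩
    ⟦ P ⟧ q                                ≡⟨ cong ⟦ P ⟧ q≡ ⟨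
    ⟦ P ⟧ (k₀ + suc (q ∸ k))               ≡⟨ ⟦fullRowsWord⟧-tail n k₀ (suc (q ∸ k)) (s≤s z≤n) (≤-trans (≤-reflexive q≡) (≤-trans (<⇒≤ q<k+b) k+b≤n)) ⟩
    suc (q ∸ k)                            ∎
    where
    open ≡-Reasoning
    q≡ : k₀ + suc (q ∸ k) ≡ q
    q≡ = trans (+-suc k₀ (q ∸ k)) (m+[n∸m]≡n k≤q)

  x-at-k+b₀ : at x (k + b₀) ≡ b
  x-at-k+b₀ = trans (x-block (k + b₀) (m≤m+n k b₀) (+-monoʳ-< k (n<1+n b₀))) (cong suc (m+n∸m≡n k b₀))

  y : ℕ
  y = at x (k + b)

  b<y : b < y
  b<y = subst (b <_) (sym y≡) (+≤⇒≤∸ k₀ (suc b) q (≤-trans (≤-reflexive (+-suc k₀ b)) k+b≤q))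
    where
    q : ℕ
    q = ⟦ high ⟧ (k + b)
    k+b≤q : k + b ≤ q
    k+b≤q = proj₁ (⟦⟧-preserves-interval (k + b) n high (k + b) high-ok ≤-refl k+b≤n)
    q≤n : q ≤ n
    q≤n = proj₂ (⟦⟧-preserves-interval (k + b) n high (k + b) high-ok ≤-refl k+b≤n)
    q≡ : k₀ + (q ∸ k₀) ≡ q
    q≡ = m+[n∸m]≡n (≤-trans (≤-trans (n≤1+n k₀) (m≤m+n k b)) k+b≤q)
    y≡ : y ≡ q ∸ k₀
    y≡ = trans (at-x (k + b) (s≤s z≤n) k+b≤n)
           (trans (cong ⟦ P ⟧ (sym q≡))
             (⟦fullRowsWord⟧-tail n k₀ (q ∸ k₀) (≤-trans (s≤s z≤n) (+≤⇒≤∸ k₀ (suc b) q (≤-trans (≤-reflexive (+-suc k₀ b)) k+b≤q)))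
               (≤-trans (≤-reflexive q≡) q≤n)))

  u u′ : List ℕ
  u  = applyWord x B′
  u′ = applyWord x B

  at-u′ : ∀ p → at u′ p ≡ at x (⟦ B ⟧ p)
  at-u′ p = at-applyWord x B p (validWord-cast length-x (descWord-valid n k b₀ (s≤s z≤n) k+b₀≤n))

  u′-at-k : at u′ k ≡ b
  u′-at-k = trans (at-u′ k) (trans (cong (at x) (⟦descWord⟧-start k b₀)) x-at-k+b₀)

  u′-at-k+b : at u′ (k + b) ≡ y
  u′-at-k+b = trans (at-u′ (k + b)) (cong (at x) (⟦descWord⟧-outside k b₀ (k + b) (inj₂ (+-monoʳ-< k (n<1+n b₀)))))

  -- B′ = s_{k+b₀} B, and s_{k+b₀} exchanges the positions of the values b and y in x.
  u-transposed : ∀ p → 1 ≤ p → p ≤ n → at u p ≡ transpose b y (at u′ p)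
  u-transposed p 1≤p p≤n =
    let (1≤q , q≤n) = ⟦⟧-preserves-interval 1 n B p (descWord-valid n k b₀ (s≤s z≤n) k+b₀≤n) 1≤p p≤n in
    trans (at-applyWord x B′ p (validWord-cast length-x (descWord-valid n k b (s≤s z≤n) k+b≤n)))
      (trans (at-transpose n x x-injective (s≤s z≤n) k+b₀≤n (s≤s z≤n) (subst (_≤ n) (+-suc k b₀) k+b≤n)
                x-at-k+b₀ (cong (at x) (sym (+-suc k b₀))) (⟦ B ⟧ p) 1≤q q≤n)
        (cong (transpose b y) (sym (at-u′ p))))

  between⇒>k+b : ∀ q → k < q → q ≤ n → b < at u′ q → at u′ q < y → k + b < q
  between⇒>k+b q k<q q≤n b<q q<y with <-cmp q (k + b)
  ... | tri> _ _ gt   = gt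
  ... | tri≈ _ refl _ = ⊥-elim (<-irrefl u′-at-k+b q<y)
  between⇒>k+b (suc q₀) k<q q≤n b<q q<y | tri< lt _ _ =
    ⊥-elim (<-irrefl refl (<-trans (subst (b <_) at-q b<q) (s≤s offset<b₀)))
    where
    q₀<k+b₀ : q₀ < k + b₀
    q₀<k+b₀ = ≤-pred (subst (suc q₀ <_) (+-suc k b₀) lt)
    at-q : at u′ (suc q₀) ≡ suc (q₀ ∸ k)
    at-q = trans (at-u′ (suc q₀)) (trans (cong (at x) (⟦descWord⟧-shift k b₀ q₀ (≤-pred k<q) q₀<k+b₀))
             (x-block q₀ (≤-pred k<q) (<-trans q₀<k+b₀ (+-monoʳ-< k (n<1+n b₀)))))
    offset<b₀ : q₀ ∸ k < b₀
    offset<b₀ = subst (q₀ ∸ k <_) (m+n∸m≡n k b₀) (∸-monoˡ-< q₀<k+b₀ (≤-pred k<q))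

  open ValueTransposition n k b y (s≤s z≤n) b<y

  invariant₀ : Invariant u u′
  invariant₀ = record
    { length-u   = trans (length-applyWord x B′) length-x
    ; length-u′  = trans (length-applyWord x B) length-x
    ; injective  = applyWord-injectiveOn n x B length-x (descWord-valid n k b₀ (s≤s z≤n) k+b₀≤n) x-injective
    ; transposed = u-transposed
    ; at-k       = u′-at-k
    ; j          = k + b
    ; k<j        = subst (k <_) (sym (+-suc k b₀)) (s≤s (m≤m+n k b₀))
    ; j≤n        = k+b≤n
    ; at-j       = u′-at-k+b
    ; between⇒>j = between⇒>k+b
    }

  module _ (reduced : length (d n R) ≡ inv (wOf n R)) where

    ascending-d : Ascending (range n) (P ++ high ++ B ++ later)
    ascending-d = subst (Ascending (range n)) d-before
      (inv-applyWord-tight⇒ascending n (range n) (d n R) (length-range n) d-valid (range-injectiveOn n) (begin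
        inv (applyWord (range n) (d n R))  ≡⟨ cong inv (prod≡applyWord n (d n R) d-valid) ⟨
        inv (wOf n R)                      ≡⟨ reduced ⟨
        length (d n R)                     ≡⟨ +-identityʳ _ ⟨
        length (d n R) + 0                 ≡⟨ cong (length (d n R) +_) (inv-range n) ⟨
        length (d n R) + inv (range n)     ∎))
      where open ≡-Reasoning

    ascending-P : Ascending (range n) P
    ascending-P = proj₁ (ascending-++⁻ (range n) P _ ascending-d)

    ascending-high : Ascending (applyWord (range n) P) high
    ascending-high = proj₁ (ascending-++⁻ _ high _ (proj₂ (ascending-++⁻ (range n) P _ ascending-d)))

    ascending-later : Ascending u′ later
    ascending-later = proj₂ (ascending-++⁻ x B later (proj₂ (ascending-++⁻ _ high _ (proj₂ (ascending-++⁻ (range n) P _ ascending-d)))))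

    ascending-B′ : Ascending x B′
    ascending-B′ = descWord-ascending k b x (s≤s z≤n) (subst (k + b ≤_) (sym length-x) k+b≤n)
      (λ q k≤q q<k+b → subst (_< y) (sym (x-block q k≤q q<k+b)) (≤-<-trans (subst (q ∸ k <_) (m+n∸m≡n k b) (∸-monoˡ-< q<k+b k≤q)) b<y))

    transferred : Ascending u later × Invariant (applyWord u later) (applyWord u′ later)
    transferred = invariant-along later later-ok invariant₀ ascending-later

    ascending-d′ : Ascending (range n) (d n R′)
    ascending-d′ = subst (Ascending (range n)) (sym d-after)
      (ascending-++⁺ (range n) P _ ascending-P
        (ascending-++⁺ _ high _ ascending-high (ascending-++⁺ x B′ later ascending-B′ (proj₁ transferred))))

    reduced′ : inv (wOf n R′) ≡ length (d n R′)
    reduced′ = begin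
      inv (wOf n R′)                             ≡⟨ cong inv (prod≡applyWord n (d n R′) d′-valid) ⟩
      inv (applyWord (range n) (d n R′))         ≡⟨ inv-applyWord-ascending (range n) (d n R′) (validWord-cast (length-range n) d′-valid) ascending-d′ ⟩
      length (d n R′) + inv (range n)            ≡⟨ cong (length (d n R′) +_) (inv-range n) ⟩
      length (d n R′) + 0                        ≡⟨ +-identityʳ _ ⟩
      length (d n R′)                            ∎
      where open ≡-Reasoning

    labeledCover : LabeledCover n (wOf n R) (k , b) (wOf n R′)
    labeledCover = subst₂ (λ w w′ → LabeledCover n w (k , b) w′)
      (sym (wOf-via-x R B d-before d-valid)) (sym (wOf-via-x R′ B′ d-after d′-valid))
      (invariant⇒labeledCover (proj₂ transferred))

all-range : ∀ {P : ℕ → Set} m → (∀ x → 1 ≤ x → x ≤ m → P x) → All P (range m)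
all-range m h = map⁺ (applyUpTo⁺₁ id m (λ {i} i<m → h (suc i) (s≤s z≤n) i<m))

range-sorted : ∀ m → AllPairs _<_ (range m)
range-sorted m = subst (AllPairs _<_) (sym (map-upTo suc m)) (AllPairs.applyUpTo⁺₁ suc m (λ i<j _ → s≤s i<j))

∈-range : ∀ {m x} → 1 ≤ x → x ≤ m → x ∈ range m
∈-range {x = suc x} _ x<m = ∈-map⁺ suc (∈-upTo⁺ x<m)

lexRow : ℕ → ℕ → List (ℕ × ℕ)
lexRow n k = map (k ,_) (range (n ∸ k))

PnLex-sorted : ∀ n → AllPairs _<lex_ (PnLex n)
PnLex-sorted n = AllPairs.concat⁺
  (map⁺ (All.universal (λ k → AllPairs.map⁺ (AllPairs.map (λ b<b′ → inj₂ (refl , b<b′)) (range-sorted (n ∸ k)))) (range n)))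
  (AllPairs.map⁺ (AllPairs.map (λ {k} {k′} k<k′ →
      map⁺ (All.universal (λ _ → map⁺ (All.universal (λ _ → inj₁ k<k′) (range (n ∸ k′)))) (range (n ∸ k))))
    (range-sorted n)))

∈-PnLex : ∀ n {q} → InPn n q → q ∈ PnLex n
∈-PnLex n {k , b} (1≤k , 1≤b , k+b≤n) =
  ∈-concat⁺′ (∈-map⁺ (k ,_) (∈-range 1≤b (+≤⇒≤∸ k b n k+b≤n))) (∈-map⁺ (lexRow n) (∈-range 1≤k (≤-trans (m≤m+n k b) k+b≤n)))

PnLex-InPn : ∀ n → All (InPn n) (PnLex n)
PnLex-InPn n = concat⁺ (map⁺ (all-range n λ k 1≤k _ → map⁺ (all-range (n ∸ k) λ b 1≤b b≤ →
  1≤k , 1≤b , ≤∸⇒+≤ k n b b≤ 1≤b)))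

PnRC-InPn : ∀ n → All (InPn n) (PnRC n)
PnRC-InPn n = subst (All (InPn n)) (sym (PnRC≡rcRows n)) (concat⁺ (map⁺ (all-consecutive 1 n λ k 1≤k _ →
  map⁺ (all-countdown (n ∸ k) λ b 1≤b b≤ → 1≤k , 1≤b , ≤∸⇒+≤ k n b b≤ 1≤b))))

<lex-asym : ∀ {p q} → p <lex q → ¬ (q <lex p)
<lex-asym (inj₁ k<j)        (inj₁ j<k)        = <-asym k<j j<k
<lex-asym (inj₁ k<j)        (inj₂ (refl , _)) = <-irrefl refl k<j
<lex-asym (inj₂ (refl , _)) (inj₁ j<k)        = <-irrefl refl j<k
<lex-asym (inj₂ (_ , b<a))  (inj₂ (_ , a<b))  = <-asym b<a a<b

<lex-trichotomy : ∀ p q → p <lex q ⊎ p ≡ q ⊎ q <lex p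
<lex-trichotomy (k , b) (j , a) with <-cmp k j
... | tri< k<j _ _ = inj₁ (inj₁ k<j)
... | tri> _ _ j<k = inj₂ (inj₂ (inj₁ j<k))
... | tri≈ _ refl _ with <-cmp b a
...   | tri< b<a _ _ = inj₁ (inj₂ (refl , b<a))
...   | tri≈ _ refl _ = inj₂ (inj₁ refl)
...   | tri> _ _ a<b = inj₂ (inj₂ (inj₂ (refl , a<b)))

firstMissing-just : ∀ (R : Subset) L {p} → firstMissing R L ≡ just p →
  ∃[ L₁ ] ∃[ L₂ ] L ≡ L₁ ++ p ∷ L₂ × All (λ q → R q ≡ true) L₁ × R p ≡ false
firstMissing-just R (x ∷ L) eq with R x in Rx
firstMissing-just R (x ∷ L) refl | false = [] , L , refl , [] , Rx
... | true = let (L₁ , L₂ , L≡ , present , absent) = firstMissing-just R L eq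
             in x ∷ L₁ , L₂ , cong (x ∷_) L≡ , Rx ∷ present , absent

firstMissing-nothing : ∀ (R : Subset) L → firstMissing R L ≡ nothing → All (λ q → R q ≡ true) L
firstMissing-nothing R []      _  = []
firstMissing-nothing R (x ∷ L) eq with R x in Rx
... | true = Rx ∷ firstMissing-nothing R L eq

nextPair-InPn : ∀ n R {p} → nextPair n R ≡ just p → InPn n p
nextPair-InPn n R {p} eq =
  let (L₁ , _ , L≡ , _) = firstMissing-just R (PnLex n) eq
  in All.lookup (PnLex-InPn n) (subst (p ∈_) (sym L≡) (∈-++⁺ʳ L₁ (here refl)))

nextPair-absent : ∀ n R {p} → nextPair n R ≡ just p → R p ≡ false
nextPair-absent n R eq = let (_ , _ , _ , _ , absent) = firstMissing-just R (PnLex n) eq in absent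

nextPair-containsLexBelow : ∀ n R {p} → nextPair n R ≡ just p → ContainsLexBelow n R p
nextPair-containsLexBelow n R {p} eq q q∈Pn q<p
  with (L₁ , L₂ , L≡ , present , _) ← firstMissing-just R (PnLex n) eq
  with ∈-++⁻ L₁ (subst (q ∈_) L≡ (∈-PnLex n q∈Pn))
... | inj₁ q∈L₁         = All.lookup present q∈L₁
... | inj₂ (here refl)  = ⊥-elim (<lex-asym q<p q<p)
... | inj₂ (there q∈L₂) = ⊥-elim (<lex-asym q<p (All.lookup (AllPairs.head (suffix-sorted L₁ (subst (AllPairs _<lex_) L≡ (PnLex-sorted n)))) q∈L₂))
  where
  suffix-sorted : ∀ L₁ {L₂} → AllPairs _<lex_ (L₁ ++ L₂) → AllPairs _<lex_ L₂
  suffix-sorted []       sorted       = sorted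
  suffix-sorted (_ ∷ L₁) sorted = suffix-sorted L₁ (AllPairs.tail sorted)

nextPair-nothing : ∀ n R → nextPair n R ≡ nothing → All (λ q → R q ≡ true) (PnRC n)
nextPair-nothing n R eq = All.map (All.lookup (firstMissing-nothing R (PnLex n) eq) ∘ ∈-PnLex n) (PnRC-InPn n)

length-d : ∀ n R → length (d n R) ≡ length (filterᵇ R (PnRC n))
length-d n R = length-map _ (filterᵇ R (PnRC n))

nextPair-exists : ∀ n R → length (d n R) < length (PnRC n) → ∃[ p ] nextPair n R ≡ just p
nextPair-exists n R short with nextPair n R in eq
... | just p  = p , refl
... | nothing = ⊥-elim (<-irrefl (trans (length-d n R) (cong length (filterᵇ-all R (nextPair-nothing n R eq)))) short)

nextPair-increasing : ∀ n R {p q} → nextPair n R ≡ just p → nextPair n (insert p R) ≡ just q → p <lex q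
nextPair-increasing n R {p} {q} eq eq′ with <lex-trichotomy p q
... | inj₁ p<q        = p<q
... | inj₂ (inj₁ refl) = ⊥-elim (true≢false (trans (sym (insert-self (proj₁ p) (proj₂ p) R)) (nextPair-absent n (insert p R) eq′)))
... | inj₂ (inj₂ q<p) = ⊥-elim (true≢false (trans (sym (insert-⊇ p R q (nextPair-containsLexBelow n R eq q (nextPair-InPn n (insert p R) eq′) q<p)))
                                                    (nextPair-absent n (insert p R) eq′)))

Reduced : ℕ → Subset → Set
Reduced n R = length (d n R) ≡ inv (wOf n R)

insert-nextPair : ∀ n R {p} → nextPair n R ≡ just p → Reduced n R →
  ValidWord n (d n (insert p R)) × Reduced n (insert p R) × length (d n (insert p R)) ≡ suc (length (d n R))
  × LabeledCover n (wOf n R) p (wOf n (insert p R))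
insert-nextPair n R {p} eq reduced with nextPair-InPn n R eq
... | (s≤s {n = k₀} z≤n , s≤s {n = b₀} z≤n , k+b≤n) =
  d′-valid , sym (reduced′ reduced) , length-d′ , labeledCover reduced
  where open InsertionStep n k₀ b₀ R k+b≤n (nextPair-containsLexBelow n R eq) (nextPair-absent n R eq)

d-full : ∀ n R → All (λ q → R q ≡ true) (PnRC n) → d n R ≡ fullRowsWord n n
d-full n R full = begin
  d n R                                                           ≡⟨ map-cong (λ { (k , b) → refl }) (filterᵇ R (PnRC n)) ⟩
  map letter (filterᵇ R (PnRC n))                                 ≡⟨ cong (map letter) (filterᵇ-all R full) ⟩
  map letter (PnRC n)                                             ≡⟨ cong (map letter) (PnRC≡rcRows n) ⟩
  map letter (concatMap (rcRow n) (consecutive 1 n))              ≡⟨ map-concatMap letter (rcRow n) (consecutive 1 n) ⟩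
  concatMap (map letter ∘ rcRow n) (consecutive 1 n)              ≡⟨ concatMap-cong (λ j → letters-rowSegment j (n ∸ j)) (consecutive 1 n) ⟩
  fullRowsWord n n                                                ∎
  where open ≡-Reasoning

wOf-full : ∀ n R → All (λ q → R q ≡ true) (PnRC n) → wOf n R ≡ w₀ n
wOf-full n R full = begin
  wOf n R                                  ≡⟨ cong (prod n) (d-full n R full) ⟩
  prod n (fullRowsWord n n)                ≡⟨ prod≡applyWord n (fullRowsWord n n) (fullRowsWord-valid n n ≤-refl) ⟩
  applyWord (range n) (fullRowsWord n n)   ≡⟨ applyWord-fullRowsWord n ⟩
  w₀ n                                     ∎
  where open ≡-Reasoning

chain-suc : ∀ n R i {p} → nextPair n (chain n R i) ≡ just p → chain n R (suc i) ≡ insert p (chain n R i)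
chain-suc n R i eq with nextPair n (chain n R i)
chain-suc n R i refl | just _ = refl

module Chain (n : ℕ) (R : Subset) (valid : ValidWord n (d n R)) (reduced : Reduced n R) where

  Rᵢ : ℕ → Subset
  Rᵢ = chain n R

  steps : ℕ
  steps = length (PnRC n) ∸ length (d n R)

  steps-total : length (d n R) + steps ≡ length (PnRC n)
  steps-total = m+[n∸m]≡n (subst (_≤ length (PnRC n)) (sym (length-d n R)) (length-filter (T? ∘ R) (PnRC n)))

  Progress : ℕ → Set
  Progress i = ValidWord n (d n (Rᵢ i)) × Reduced n (Rᵢ i) × length (d n (Rᵢ i)) ≡ length (d n R) + i

  shorter : ∀ i → length (d n (Rᵢ i)) ≡ length (d n R) + i → i < steps → length (d n (Rᵢ i)) < length (PnRC n)
  shorter i len i<steps = subst₂ _<_ (sym len) steps-total (+-monoʳ-< (length (d n R)) i<steps)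

  progress : ∀ i → i ≤ steps → Progress i
  progress zero    _          = valid , reduced , sym (+-identityʳ _)
  progress (suc i) i<steps
    with (valid′ , reduced′ , len′) ← progress i (<⇒≤ i<steps)
    with (p , eq) ← nextPair-exists n (Rᵢ i) (shorter i len′ i<steps)
    with (valid″ , reduced″ , len″ , _) ← insert-nextPair n (Rᵢ i) eq reduced′
    rewrite chain-suc n R i eq =
      valid″ , reduced″ , trans len″ (trans (cong suc len′) (sym (+-suc _ i)))

  nextPair-before-end : ∀ i → i < steps → ∃[ p ] nextPair n (Rᵢ i) ≡ just p
  nextPair-before-end i i<steps = nextPair-exists n (Rᵢ i) (shorter i (proj₂ (proj₂ (progress i (<⇒≤ i<steps)))) i<steps)

  full-at-end : All (λ q → Rᵢ steps q ≡ true) (PnRC n)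
  full-at-end = filterᵇ-complete (Rᵢ steps) (PnRC n)
    (trans (sym (length-d n (Rᵢ steps))) (trans (proj₂ (proj₂ (progress steps ≤-refl))) steps-total))

  rcGraph : ∀ i → i ≤ steps → IsRCGraph n (Rᵢ i)
  rcGraph i i≤steps = let (valid′ , reduced′ , _) = progress i i≤steps in
    wOf n (Rᵢ i) , subst (_↭ range n) (sym (prod≡applyWord n (d n (Rᵢ i)) valid′)) (applyWord-↭ (range n) (d n (Rᵢ i))) ,
    valid′ , refl , reduced′

  labeledCover : ∀ i {p} → i < steps → nextPair n (Rᵢ i) ≡ just p → LabeledCover n (wOf n (Rᵢ i)) p (wOf n (Rᵢ (suc i)))
  labeledCover i i<steps eq rewrite chain-suc n R i eq =
    proj₂ (proj₂ (proj₂ (insert-nextPair n (Rᵢ i) eq (proj₁ (proj₂ (progress i (<⇒≤ i<steps)))))))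

  steps≡ : inv (w₀ n) ∸ length (d n R) ≡ steps
  steps≡ = begin
    inv (w₀ n) ∸ length (d n R)                   ≡⟨ cong (λ w → inv w ∸ length (d n R)) (wOf-full n (Rᵢ steps) full-at-end) ⟨
    inv (wOf n (Rᵢ steps)) ∸ length (d n R)       ≡⟨ cong (_∸ length (d n R)) (sym reduced-end) ⟩
    length (d n (Rᵢ steps)) ∸ length (d n R)      ≡⟨ cong (_∸ length (d n R)) length-end ⟩
    length (d n R) + steps ∸ length (d n R)       ≡⟨ m+n∸m≡n (length (d n R)) steps ⟩
    steps                                         ∎
    where
    open ≡-Reasoning
    reduced-end : Reduced n (Rᵢ steps)
    reduced-end = proj₁ (proj₂ (progress steps ≤-refl))
    length-end : length (d n (Rᵢ steps)) ≡ length (d n R) + steps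
    length-end = proj₂ (proj₂ (progress steps ≤-refl))

  cover : ∀ i → i < steps → Cover n (wOf n (Rᵢ i)) (wOf n (Rᵢ (suc i)))
  cover i i<steps = let (p , eq) = nextPair-before-end i i<steps
                        (i′ , j′ , covers , _) = labeledCover i i<steps eq
                    in i′ , j′ , covers

  increasing : ∀ i {p q} → nextPair n (Rᵢ i) ≡ just p → nextPair n (Rᵢ (suc i)) ≡ just q → p <lex q
  increasing i eq eq′ = nextPair-increasing n (Rᵢ i) eq (subst (λ T → nextPair n T ≡ just _) (chain-suc n R i eq) eq′)

ChainProperties : ℕ → List ℕ → Subset → ℕ → Set
ChainProperties n w R L =
    (∀ i → i < L → ∃[ p ] nextPair n (chain n R i) ≡ just p)
    × All (λ p → chain n R L p ≡ true) (PnRC n)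
    × (∀ i → i ≤ L → IsRCGraph n (chain n R i))
    × wOf n (chain n R 0) ≡ w
    × wOf n (chain n R L) ≡ w₀ n
    × (∀ i → i < L → Cover n (wOf n (chain n R i)) (wOf n (chain n R (suc i))))
    × (∀ i k b → i < L → nextPair n (chain n R i) ≡ just (k , b) →
         LabeledCover n (wOf n (chain n R i)) (k , b) (wOf n (chain n R (suc i))))
    × (∀ i k b k′ b′ → suc i < L → nextPair n (chain n R i) ≡ just (k , b) →
         nextPair n (chain n R (suc i)) ≡ just (k′ , b′) → (k , b) <lex (k′ , b′))

lemma2p2 : (n : ℕ) (w : List ℕ) (R : Subset) →
    SubsetOfPn n R → IsRCGraphOf n R w →
    -- Rᵢ ≠ Pₙ for i < ℓ(w₀) - ℓ(w), and R_{ℓ(w₀)-ℓ(w)} = Pₙ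
    (∀ i → i < inv (w₀ n) ∸ inv w → ∃[ p ] nextPair n (chain n R i) ≡ just p)
    × All (λ p → chain n R (inv (w₀ n) ∸ inv w) p ≡ true) (PnRC n)
    -- (1)
    × (∀ i → i ≤ inv (w₀ n) ∸ inv w → IsRCGraph n (chain n R i))
    -- (2)
    × wOf n (chain n R 0) ≡ w
    × wOf n (chain n R (inv (w₀ n) ∸ inv w)) ≡ w₀ n
    × (∀ i → i < inv (w₀ n) ∸ inv w →
         Cover n (wOf n (chain n R i)) (wOf n (chain n R (suc i))))
    -- (3)
    × (∀ i k b → i < inv (w₀ n) ∸ inv w → nextPair n (chain n R i) ≡ just (k , b) →
         LabeledCover n (wOf n (chain n R i)) (k , b) (wOf n (chain n R (suc i))))
    -- (4)
    × (∀ i k b k′ b′ → suc i < inv (w₀ n) ∸ inv w →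
         nextPair n (chain n R i) ≡ just (k , b) →
         nextPair n (chain n R (suc i)) ≡ just (k′ , b′) →
         (k , b) <lex (k′ , b′))
lemma2p2 n w R _ (_ , valid , prod≡w , length≡inv) =
  subst (ChainProperties n w R) (sym (trans (cong (inv (w₀ n) ∸_) (sym length≡inv)) steps≡))
    ( nextPair-before-end
    , full-at-end
    , rcGraph
    , prod≡w
    , wOf-full n (Rᵢ steps) full-at-end
    , cover
    , (λ i _ _ → labeledCover i)
    , (λ i _ _ _ _ _ → increasing i) )
  where
  reduced : Reduced n R
  reduced = trans length≡inv (cong inv (sym prod≡w))
  open Chain n R valid reduced
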